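{- Let $G$ be a nontrivial finite abelian group. Then the nim-number of $\mathsf{DNG}(G)$ is $1$ if $G$ has odd order; $1$ if $G\cong\mathbb{Z}_2$; $3$ if $G\cong\mathbb{Z}_2\times\mathbb{Z}_{2k+1}$ for some integer $k\ge1$; and $0$ in all other cases.
   Context: For a nontrivial finite group $G$, the avoidance game $\mathsf{DNG}(G)$ is the impartial game (normal play) whose positions are the subsets $P\subseteq G$ with $\langle P\rangle\neq G$, starting position $\emptyset$, options $\operatorname{Opt}(P)=\{P\cup\{g\}:g\in G\setminus P,\ \langle P\cup\{g\}\rangle\neq G\}$; $\operatorname{nim}(P)=\operatorname{mex}\{\operatorname{nim}(Q):Q\in\operatorname{Opt}(P)\}$ ($\operatorname{mex}$ = least nonnegative integer not in the set) and the nim-number of the game is $\operatorname{nim}(\emptyset)$. $\mathbb{Z}_n$ is the cyclic group of order $n$. -}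

module Defs where

open import Data.Nat using (ℕ; zero; suc; _+_; _*_; _<_; _≤_; _%_; NonZero)
open import Data.Nat.DivMod using (m%n<n)
open import Data.Fin using (Fin; toℕ; fromℕ<)
open import Data.Fin.Subset using (Subset; _∈_; _∉_; _∪_; ⁅_⁆; ⊥)
open import Data.Product using (Σ; _×_; _,_; ∃)
open import Relation.Nullary using (¬_)
open import Relation.Binary.PropositionalEquality using (_≡_; _≢_)
open import Algebra.Structures using (IsAbelianGroup)
open import Function.Definitions using (Bijective)

-- A finite abelian group, presented (up to isomorphism) on the carrier Fin order
-- with propositional equality.
record FiniteAbelianGroup : Set where
  field
    order : ℕ
    _∙_ : Fin order → Fin order → Fin order
    ε : Fin order
    _⁻¹ : Fin order → Fin order
    isAbelianGroup : IsAbelianGroup _≡_ _∙_ ε _⁻¹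

module _ (G : FiniteAbelianGroup) where
  open FiniteAbelianGroup G

  data ⟨_⟩∋_ (P : Subset order) : Fin order → Set where
    gen : ∀ {g} → g ∈ P → ⟨ P ⟩∋ g
    idt : ⟨ P ⟩∋ ε
    mul : ∀ {g h} → ⟨ P ⟩∋ g → ⟨ P ⟩∋ h → ⟨ P ⟩∋ (g ∙ h)
    inv : ∀ {g} → ⟨ P ⟩∋ g → ⟨ P ⟩∋ (g ⁻¹)

  IsPosition : Subset order → Set
  IsPosition P = ¬ (∀ g → ⟨ P ⟩∋ g)

  -- f computes nim-values of DNG(G): on every position P,
  -- f P = mex { f (P ∪ {g}) : g ∉ P, ⟨P ∪ {g}⟩ ≠ G }
  IsNimFunction : (Subset order → ℕ) → Set
  IsNimFunction f = ∀ P → IsPosition P →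
      (∀ g → g ∉ P → IsPosition (P ∪ ⁅ g ⁆) → f (P ∪ ⁅ g ⁆) ≢ f P)
    × (∀ m → m < f P → ∃ λ g → g ∉ P × IsPosition (P ∪ ⁅ g ⁆) × f (P ∪ ⁅ g ⁆) ≡ m)

  NimNumberIs : ℕ → Set
  NimNumberIs v = (∃ λ f → IsNimFunction f) × (∀ f → IsNimFunction f → f ⊥ ≡ v)

  IsoTo : (A : Set) → (A → A → A) → Set
  IsoTo A _⊕_ = Σ (Fin order → A) λ φ →
    Bijective _≡_ _≡_ φ × (∀ x y → φ (x ∙ y) ≡ φ x ⊕ φ y)

addℤ : (m : ℕ) → Fin m → Fin m → Fin m
addℤ zero () _
addℤ (suc m) a b = fromℕ< (m%n<n (toℕ a + toℕ b) (suc m))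

addℤ2× : (m : ℕ) → (Fin 2 × Fin m) → (Fin 2 × Fin m) → (Fin 2 × Fin m)
addℤ2× m (a , b) (c , d) = addℤ 2 a c , addℤ m b d

IsoℤZ2 : FiniteAbelianGroup → Set
IsoℤZ2 G = IsoTo G (Fin 2) (addℤ 2)

IsoZ2×Z : FiniteAbelianGroup → ℕ → Set
IsoZ2×Z G m = IsoTo G (Fin 2 × Fin m) (addℤ2× m)

OddOrder : FiniteAbelianGroup → Set
OddOrder G = FiniteAbelianGroup.order G % 2 ≡ 1

module Submission where

-- A position is terminal exactly when it is a maximal proper subgroup. If all maximal subgroups have
-- orders of the same parity, the game is a pure parity count and nim(P) is the parity of the number of
-- moves left: this gives 1 for odd ∣ G ∣, whose subgroups all have odd order, and 0 when 4 divides ∣ G ∣,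
-- since a maximal subgroup then contains an involution or has index 2 (and hence even order).
-- Otherwise ∣ G ∣ = 2m with m odd, G = H × ℤ₂ for the subgroup H of odd order m, and the nim value of P is
--   parity ∣ P ∣          if P ⊈ H,
--   parity (∣ P ∣ + 1)    if P ⊆ H generates H (every move then stays inside H),
--   2 + parity (∣ P ∣ + 1) if P ⊆ H is one element short of generating H,
--   parity ∣ P ∣          otherwise.
-- At P = ∅ this is 1 if H is trivial (G ≅ ℤ₂), 3 if H is cyclic and nontrivial, and 0 otherwise.

open import Defs hiding (⟨_⟩∋_)
import Defs
open import Data.Nat using (ℕ; zero; suc; _+_; _*_; _≤_; _<_; _∸_; z≤n; s≤s; _%_; NonZero)
import Data.Nat as ℕ using (pred; >-nonZero; ≢-nonZero)
import Data.Nat.Properties as ℕ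
import Data.Nat.DivMod as ℕ
open import Data.Product using (_×_; ∃; _,_; proj₁; proj₂)
open import Data.Sum using (_⊎_; inj₁; inj₂)
open import Data.Empty using (⊥-elim)
open import Data.Unit using (tt) renaming (⊤ to Unit)
open import Data.Bool using (Bool; true; false; _∧_; not; if_then_else_)
import Data.Bool.Properties as Bool
open import Data.Fin using (Fin; toℕ; fromℕ<; punchOut) renaming (zero to fzero; suc to fsuc)
import Data.Fin.Properties as Fin
open import Data.Fin.Subset using (Subset; _∈_; _∉_; _∪_; ⁅_⁆; ⊥; ⊤; ∣_∣; inside; outside; _⊆_; _⊂_)
import Data.Fin.Subset.Properties as Subset
open import Data.Fin.Permutation using (permutation)
open import Data.Vec using (_∷_; []; here; there; tabulate)
import Data.Vec.Properties as Vec
open import Function using (_∘_; id)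
open import Function.Definitions using (Injective)
open import Relation.Nullary using (¬_; Dec; yes; no; does)
open import Relation.Nullary.Decidable using (dec-true; dec-false; does-⇔; decidable-stable; _×-dec_; _⊎-dec_; _→-dec_; ¬?)
open import Function.Bundles using (mk⇔; _↔_; Inverse)
open import Function.Properties.Inverse using (↔-refl)
open import Relation.Unary using (Pred; Decidable)
open import Level using (0ℓ)
open import Relation.Binary using (tri<; tri≈; tri>)
open import Relation.Binary.PropositionalEquality
import Algebra.Properties.CommutativeMonoid.Sum as MonoidSum
open import Algebra.Bundles using (AbelianGroup)

parity : ℕ → ℕ
parity zero = 0
parity (suc n) = 1 ∸ parity n

parity-0⊎1 : ∀ n → parity n ≡ 0 ⊎ parity n ≡ 1
parity-0⊎1 zero = inj₁ refl
parity-0⊎1 (suc n) with parity n | parity-0⊎1 n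
... | _ | inj₁ refl = inj₂ refl
... | _ | inj₂ refl = inj₁ refl

parity≤1 : ∀ n → parity n ≤ 1
parity≤1 n with parity-0⊎1 n
... | inj₁ e = ℕ.≤-trans (ℕ.≤-reflexive e) z≤n
... | inj₂ e = ℕ.≤-reflexive e

parity-suc-0 : ∀ n → parity n ≡ 0 → parity (suc n) ≡ 1
parity-suc-0 _ e = cong (1 ∸_) e

parity-suc-1 : ∀ n → parity n ≡ 1 → parity (suc n) ≡ 0
parity-suc-1 _ e = cong (1 ∸_) e

parity-suc≢ : ∀ n → parity (suc n) ≢ parity n
parity-suc≢ n with parity-0⊎1 n
... | inj₁ e rewrite e = λ ()
... | inj₂ e rewrite e = λ ()

parity-suc-< : ∀ {m} n → m < parity n → parity (suc n) ≡ m
parity-suc-< n lt with parity-0⊎1 n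
... | inj₁ e = ⊥-elim (ℕ.n≮0 (subst (_ <_) e lt))
... | inj₂ e = trans (parity-suc-1 n e) (sym (ℕ.n<1⇒n≡0 (subst (_ <_) e lt)))

parity-other : ∀ {v} n → v ≤ 1 → v ≢ parity n → v ≡ parity (suc n)
parity-other {v} n v≤1 v≢ with parity-0⊎1 n | ℕ.m≤n⇒m<n∨m≡n v≤1
... | inj₁ e | inj₁ (s≤s z≤n) = ⊥-elim (v≢ (sym e))
... | inj₁ e | inj₂ refl = sym (parity-suc-0 n e)
... | inj₂ e | inj₁ (s≤s z≤n) = sym (parity-suc-1 n e)
... | inj₂ e | inj₂ refl = ⊥-elim (v≢ (sym e))

parity-2+ : ∀ n → parity (2 + n) ≡ parity n
parity-2+ n with parity-0⊎1 n
... | inj₁ e rewrite e = refl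
... | inj₂ e rewrite e = refl

parity-double : ∀ k → parity (k + k) ≡ 0
parity-double zero = refl
parity-double (suc k) = begin
  parity (suc (k + suc k)) ≡⟨ cong (parity ∘ suc) (ℕ.+-suc k k) ⟩
  parity (2 + (k + k))     ≡⟨ parity-2+ (k + k) ⟩
  parity (k + k)           ≡⟨ parity-double k ⟩
  0                        ∎
  where open ≡-Reasoning

parity≡0⇒double : ∀ n → parity n ≡ 0 → ∃ λ k → n ≡ k + k
parity≡0⇒double zero _ = 0 , refl
parity≡0⇒double (suc zero) ()
parity≡0⇒double (suc (suc n)) e with parity≡0⇒double n (trans (sym (parity-2+ n)) e)
... | k , refl = suc k , cong suc (sym (ℕ.+-suc k k))

double-injective : ∀ m n → m + m ≡ n + n → m ≡ n
double-injective zero zero _ = refl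
double-injective (suc m) (suc n) e = cong suc (double-injective m n
  (ℕ.suc-injective (trans (sym (ℕ.+-suc m m)) (trans (ℕ.suc-injective e) (ℕ.+-suc n n)))))

parity-2k+1 : ∀ k → parity (2 * k + 1) ≡ 1
parity-2k+1 k = begin
  parity (2 * k + 1)    ≡⟨ cong parity (ℕ.+-comm (2 * k) 1) ⟩
  parity (suc (2 * k))  ≡⟨ parity-suc-0 (2 * k) (trans (cong (parity ∘ (k +_)) (ℕ.+-identityʳ k)) (parity-double k)) ⟩
  1                     ∎
  where open ≡-Reasoning

parity≡1⇒2k+1 : ∀ n → parity n ≡ 1 → ∃ λ k → n ≡ 2 * k + 1
parity≡1⇒2k+1 zero ()
parity≡1⇒2k+1 (suc n) odd with parity-0⊎1 n
... | inj₂ n-odd = ⊥-elim (ℕ.0≢1+n (trans (sym (parity-suc-1 n n-odd)) odd))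
... | inj₁ n-even with parity≡0⇒double n n-even
...   | k , refl = k , trans (cong (suc ∘ (k +_)) (sym (ℕ.+-identityʳ k))) (ℕ.+-comm 1 (2 * k))

3≤2k+1 : ∀ {k} → 1 ≤ k → 3 ≤ 2 * k + 1
3≤2k+1 1≤k = ℕ.+-monoˡ-≤ 1 (ℕ.*-monoʳ-≤ 2 1≤k)

n%2≡parity : ∀ n → n % 2 ≡ parity n
n%2≡parity zero = refl
n%2≡parity (suc zero) = refl
n%2≡parity (suc (suc n)) = begin
  (2 + n) % 2 ≡⟨ trans (cong (_% 2) (ℕ.+-comm 2 n)) (ℕ.[m+n]%n≡m%n n 2) ⟩
  n % 2       ≡⟨ n%2≡parity n ⟩
  parity n    ≡⟨ parity-2+ n ⟨
  parity (2 + n) ∎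
  where open ≡-Reasoning

does⇒ : ∀ {A : Set} (a? : Dec A) → does a? ≡ true → A
does⇒ (yes a) _ = a

¬∀⇒∃¬ : ∀ {n} {Q R : Pred (Fin n) 0ℓ} → Decidable Q → Decidable R → ¬ (∀ {x} → Q x → R x) → ∃ λ x → Q x × ¬ R x
¬∀⇒∃¬ Q? R? ¬∀ with Fin.any? (λ x → Q? x ×-dec ¬? (R? x))
... | yes found = found
... | no none = ⊥-elim (¬∀ λ {x} q → decidable-stable (R? x) (λ ¬r → none (x , q , ¬r)))

∪-monoˡ : ∀ {n} {P Q : Subset n} R → P ⊆ Q → P ∪ R ⊆ Q ∪ R
∪-monoˡ {P = P} {Q} R P⊆Q x∈ with Subset.x∈p∪q⁻ P R x∈
... | inj₁ x∈P = Subset.p⊆p∪q R (P⊆Q x∈P)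
... | inj₂ x∈R = Subset.q⊆p∪q Q R x∈R

∪⁅⁆-⊆ : ∀ {n} {P R : Subset n} {x} → P ⊆ R → x ∈ R → P ∪ ⁅ x ⁆ ⊆ R
∪⁅⁆-⊆ {P = P} {x = x} P⊆R x∈R y∈ with Subset.x∈p∪q⁻ P ⁅ x ⁆ y∈
... | inj₁ y∈P = P⊆R y∈P
... | inj₂ y∈x rewrite Subset.x∈⁅y⁆⇒x≡y x y∈x = x∈R

module ℕSum = MonoidSum ℕ.+-0-commutativeMonoid

count : ∀ {n} → (Fin n → Bool) → ℕ
count p = ℕSum.sum (λ x → if p x then 1 else 0)

count-cong : ∀ {n} {p q : Fin n → Bool} → (∀ x → p x ≡ q x) → count p ≡ count q
count-cong e = ℕSum.sum-cong-≗ (λ x → cong (λ b → if b then 1 else 0) (e x))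

∣p∣≡count : ∀ {n} (P : Subset n) → ∣ P ∣ ≡ count (λ x → does (x Subset.∈? P))
∣p∣≡count [] = refl
∣p∣≡count (inside ∷ P) = cong suc (∣p∣≡count P)
∣p∣≡count (outside ∷ P) = ∣p∣≡count P

count-true : ∀ n → count {n} (λ _ → true) ≡ n
count-true zero = refl
count-true (suc n) = cong suc (count-true n)

count-≡ : ∀ {n} (a : Fin n) → count (λ x → does (x Fin.≟ a)) ≡ 1
count-≡ {suc n} fzero = cong suc (count-false n)
  where
  count-false : ∀ n → count {n} (λ _ → false) ≡ 0
  count-false zero = refl
  count-false (suc n) = count-false n
count-≡ (fsuc a) = count-≡ a

count-split : ∀ {n} (p q : Fin n → Bool) → count p ≡ count (λ x → p x ∧ q x) + count (λ x → p x ∧ not (q x))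
count-split p q = trans (ℕSum.sum-cong-≗ (λ x → split (p x) (q x)))
  (ℕSum.∑-distrib-+ (λ x → if p x ∧ q x then 1 else 0) (λ x → if p x ∧ not (q x) then 1 else 0))
  where
  split : ∀ a b → (if a then 1 else 0) ≡ (if a ∧ b then 1 else 0) + (if a ∧ not b then 1 else 0)
  split true true = refl
  split true false = refl
  split false b = refl

count-permute : ∀ {n} (σ : Fin n → Fin n) → (∀ x → σ (σ x) ≡ x) → (p : Fin n → Bool) → count p ≡ count (p ∘ σ)
count-permute σ σσ p = ℕSum.sum-permute _ (permutation σ σ σσ σσ)

infix 4 _<ᵇ_
_<ᵇ_ : ∀ {n} → Fin n → Fin n → Bool
x <ᵇ y = does (x Fin.<? y)

<ᵇ-flip : ∀ {n} {x y : Fin n} → x ≢ y → (y <ᵇ x) ≡ not (x <ᵇ y)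
<ᵇ-flip {x = x} {y} x≢y with Fin.<-cmp x y
... | tri< x<y _ _ = trans (dec-false (y Fin.<? x) (ℕ.<⇒≯ x<y)) (cong not (sym (dec-true (x Fin.<? y) x<y)))
... | tri≈ _ x≡y _ = ⊥-elim (x≢y x≡y)
... | tri> _ _ y<x = trans (dec-true (y Fin.<? x) y<x) (cong not (sym (dec-false (x Fin.<? y) (ℕ.<⇒≯ y<x))))

-- Each orbit {x, σ x} of a fixed-point-free involution is counted twice by its smaller element.
count-involution : ∀ {n} (σ : Fin n → Fin n) → (∀ x → σ (σ x) ≡ x) → (p : Fin n → Bool) →
  (∀ x → p (σ x) ≡ p x) → (∀ x → p x ≡ true → σ x ≢ x) →
  let k = count (λ x → p x ∧ (x <ᵇ σ x)) in count p ≡ k + k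
count-involution σ σσ p pσ σ≢id = trans (count-split p (λ x → x <ᵇ σ x))
  (cong (count (λ x → p x ∧ (x <ᵇ σ x)) +_) (trans (count-cong larger) (sym (count-permute σ σσ (λ x → p x ∧ (x <ᵇ σ x))))))
  where
  larger : ∀ x → (p x ∧ not (x <ᵇ σ x)) ≡ (p (σ x) ∧ (σ x <ᵇ σ (σ x)))
  larger x rewrite σσ x | pσ x with p x in px
  ... | false = refl
  ... | true = sym (<ᵇ-flip (σ≢id x px ∘ sym))

injective⇒surjective : ∀ {n} {f : Fin n → Fin n} → Injective _≡_ _≡_ f → ∀ y → ∃ λ x → f x ≡ y
injective⇒surjective {zero} _ ()
injective⇒surjective {suc n} {f} f-inj y with Fin.any? (λ x → f x Fin.≟ y)
... | yes hit = hit
... | no miss = ⊥-elim (ℕ.<-irrefl refl (Fin.injective⇒≤ g-inj))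
  where
  f≢y : ∀ x → y ≢ f x
  f≢y x e = miss (x , sym e)
  g : Fin (suc n) → Fin n
  g x = punchOut (f≢y x)
  g-inj : Injective _≡_ _≡_ g
  g-inj {a} {b} e = f-inj (Fin.punchOut-injective (f≢y a) (f≢y b) e)

surjective⇒injective : ∀ {n} {f : Fin n → Fin n} → (∀ y → ∃ λ x → f x ≡ y) → Injective _≡_ _≡_ f
surjective⇒injective {n} {f} f-surj {a} {b} e = begin
  a           ≡⟨ proj₂ (section-surj a) ⟨
  section a′  ≡⟨ cong section a′≡b′ ⟩
  section b′  ≡⟨ proj₂ (section-surj b) ⟩
  b           ∎
  where
  open ≡-Reasoning
  section : Fin n → Fin n
  section y = proj₁ (f-surj y)
  f∘section : ∀ y → f (section y) ≡ y
  f∘section y = proj₂ (f-surj y)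
  section-surj : ∀ y → ∃ λ x → section x ≡ y
  section-surj = injective⇒surjective (λ {x} {y} e → trans (sym (f∘section x)) (trans (cong f e) (f∘section y)))
  a′ b′ : Fin n
  a′ = proj₁ (section-surj a)
  b′ = proj₁ (section-surj b)
  a′≡b′ : a′ ≡ b′
  a′≡b′ = begin
    a′              ≡⟨ f∘section a′ ⟨
    f (section a′)  ≡⟨ cong f (proj₂ (section-surj a)) ⟩
    f a             ≡⟨ e ⟩
    f b             ≡⟨ cong f (proj₂ (section-surj b)) ⟨
    f (section b′)  ≡⟨ f∘section b′ ⟩
    b′              ∎

toℕ-addℤ : ∀ d .{{_ : NonZero d}} (a b : Fin d) → toℕ (addℤ d a b) ≡ (toℕ a + toℕ b) % d
toℕ-addℤ (suc m) a b = Fin.toℕ-fromℕ< (ℕ.m%n<n (toℕ a + toℕ b) (suc m))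

[m+n%d]%d≡[m+n]%d : ∀ m n d .{{_ : NonZero d}} → (m + n % d) % d ≡ (m + n) % d
[m+n%d]%d≡[m+n]%d m n d = begin
  (m + n % d) % d           ≡⟨ ℕ.%-distribˡ-+ m (n % d) d ⟩
  (m % d + n % d % d) % d   ≡⟨ cong (λ k → (m % d + k) % d) (ℕ.m%n%n≡m%n n d) ⟩
  (m % d + n % d) % d       ≡⟨ ℕ.%-distribˡ-+ m n d ⟨
  (m + n) % d               ∎
  where open ≡-Reasoning

addℤ-idem⇒zero : ∀ d .{{_ : NonZero d}} (a : Fin d) → addℤ d a a ≡ a → toℕ a ≡ 0
addℤ-idem⇒zero d a e = multiple<d⇒0 q (ℕ.+-cancelˡ-≡ (toℕ a) _ _ a+a≡a+qd)
  where
  open ≡-Reasoning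
  q : ℕ
  q = (toℕ a + toℕ a) ℕ./ d
  a+a≡a+qd : toℕ a + toℕ a ≡ toℕ a + q * d
  a+a≡a+qd = begin
    toℕ a + toℕ a               ≡⟨ ℕ.m≡m%n+[m/n]*n (toℕ a + toℕ a) d ⟩
    (toℕ a + toℕ a) % d + q * d ≡⟨ cong (_+ q * d) (trans (sym (toℕ-addℤ d a a)) (cong toℕ e)) ⟩
    toℕ a + q * d               ∎
  multiple<d⇒0 : ∀ k → toℕ a ≡ k * d → toℕ a ≡ 0
  multiple<d⇒0 zero a≡0 = a≡0
  multiple<d⇒0 (suc k) a≡kd = ⊥-elim (ℕ.<⇒≱ (Fin.toℕ<n a) (subst (d ≤_) (sym a≡kd) (ℕ.m≤m+n d (k * d))))

fromDec : ∀ {n} {Q : Pred (Fin n) 0ℓ} → Decidable Q → Subset n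
fromDec Q? = tabulate (does ∘ Q?)

∈-fromDec⁻ : ∀ {n} {Q : Pred (Fin n) 0ℓ} (Q? : Decidable Q) {x} → x ∈ fromDec Q? → Q x
∈-fromDec⁻ Q? {x} x∈ with Q? x | trans (sym (Vec.lookup∘tabulate (does ∘ Q?) x)) (Vec.[]=⇒lookup x∈)
... | yes q | _ = q
... | no _ | ()

∈-fromDec⁺ : ∀ {n} {Q : Pred (Fin n) 0ℓ} (Q? : Decidable Q) {x} → Q x → x ∈ fromDec Q?
∈-fromDec⁺ Q? {x} q = Vec.lookup⇒[]= x _ (trans (Vec.lookup∘tabulate (does ∘ Q?) x) (dec-true (Q? x) q))

∣p∪⁅x⁆∣≡1+∣p∣ : ∀ {n} (P : Subset n) {x} → x ∉ P → ∣ P ∪ ⁅ x ⁆ ∣ ≡ suc ∣ P ∣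
∣p∪⁅x⁆∣≡1+∣p∣ (inside ∷ P) {fzero} x∉ = ⊥-elim (x∉ here)
∣p∪⁅x⁆∣≡1+∣p∣ (outside ∷ P) {fzero} x∉ = cong (suc ∘ ∣_∣) (Subset.∪-identityʳ P)
∣p∪⁅x⁆∣≡1+∣p∣ (inside ∷ P) {fsuc x} x∉ = cong suc (∣p∪⁅x⁆∣≡1+∣p∣ P (x∉ ∘ there))
∣p∪⁅x⁆∣≡1+∣p∣ (outside ∷ P) {fsuc x} x∉ = ∣p∪⁅x⁆∣≡1+∣p∣ P (x∉ ∘ there)

module Span (G : FiniteAbelianGroup) where
  open FiniteAbelianGroup G renaming (order to N; _∙_ to infixl 7 _∙_; _⁻¹ to infix 8 _⁻¹)

  ⟨_⟩∋_ : Subset N → Fin N → Set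
  ⟨_⟩∋_ = Defs.⟨_⟩∋_ G

  Closed : Subset N → Set
  Closed P = ∀ x → ⟨ P ⟩∋ x → x ∈ P

  ⟨⟩-mono : ∀ {P Q} → P ⊆ Q → ∀ {x} → ⟨ P ⟩∋ x → ⟨ Q ⟩∋ x
  ⟨⟩-mono P⊆Q (gen x∈P) = gen (P⊆Q x∈P)
  ⟨⟩-mono P⊆Q idt = idt
  ⟨⟩-mono P⊆Q (mul p q) = mul (⟨⟩-mono P⊆Q p) (⟨⟩-mono P⊆Q q)
  ⟨⟩-mono P⊆Q (inv p) = inv (⟨⟩-mono P⊆Q p)

  ⟨⟩-∪ˡ : ∀ {P x} Q → ⟨ P ⟩∋ x → ⟨ P ∪ Q ⟩∋ x
  ⟨⟩-∪ˡ Q = ⟨⟩-mono (Subset.p⊆p∪q Q)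

  ⟨⟩-∪-⁅⁆ : ∀ P x → ⟨ P ∪ ⁅ x ⁆ ⟩∋ x
  ⟨⟩-∪-⁅⁆ P x = gen (Subset.q⊆p∪q P ⁅ x ⁆ (Subset.x∈⁅x⁆ x))

  ⟨⟩-absorb : ∀ {P x} → ⟨ P ⟩∋ x → ∀ {h} → ⟨ P ∪ ⁅ x ⁆ ⟩∋ h → ⟨ P ⟩∋ h
  ⟨⟩-absorb {P} {x} px (gen h∈) with Subset.x∈p∪q⁻ P ⁅ x ⁆ h∈
  ... | inj₁ h∈P = gen h∈P
  ... | inj₂ h∈x rewrite Subset.x∈⁅y⁆⇒x≡y x h∈x = px
  ⟨⟩-absorb px idt = idt
  ⟨⟩-absorb px (mul p q) = mul (⟨⟩-absorb px p) (⟨⟩-absorb px q)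
  ⟨⟩-absorb px (inv p) = inv (⟨⟩-absorb px p)

  OneStep : Subset N → Pred (Fin N) 0ℓ
  OneStep S x = x ∈ S ⊎ (∃ λ a → ∃ λ b → a ∈ S × b ∈ S × a ∙ b ≡ x) ⊎ (∃ λ a → a ∈ S × a ⁻¹ ≡ x)

  oneStep? : ∀ S → Decidable (OneStep S)
  oneStep? S x = (x Subset.∈? S)
    ⊎-dec (Fin.any? λ a → Fin.any? λ b → (a Subset.∈? S) ×-dec (b Subset.∈? S) ×-dec (a ∙ b Fin.≟ x))
    ⊎-dec (Fin.any? λ a → (a Subset.∈? S) ×-dec (a ⁻¹ Fin.≟ x))

  step : Subset N → Subset N
  step S = fromDec (oneStep? S)

  ⊆-step : ∀ S → S ⊆ step S
  ⊆-step S x∈S = ∈-fromDec⁺ (oneStep? S) (inj₁ x∈S)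

  iterate : ℕ → Subset N → Subset N
  iterate zero S = S
  iterate (suc k) S = step (iterate k S)

  Stable : Subset N → Set
  Stable S = step S ≡ S

  unstable⇒⊂ : ∀ S → ¬ Stable S → S ⊂ step S
  unstable⇒⊂ S unstable = ⊆-step S ,
    ¬∀⇒∃¬ (Subset._∈? step S) (Subset._∈? S) (λ step⊆S → unstable (Subset.⊆-antisym step⊆S (⊆-step S)))

  unstable⇒large : ∀ k S → ¬ Stable (iterate k S) → k ≤ ∣ iterate k S ∣
  unstable⇒large zero S _ = z≤n
  unstable⇒large (suc k) S unstable = ℕ.≤-trans (s≤s (unstable⇒large k S unstable′))
    (Subset.p⊂q⇒∣p∣<∣q∣ (unstable⇒⊂ (iterate k S) unstable′))
    where
    unstable′ : ¬ Stable (iterate k S)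
    unstable′ stable = unstable (cong step stable)

  -- A strictly increasing chain of subsets of Fin N stabilises after at most N steps.
  iterate-stable : ∀ S → Stable (iterate N S)
  iterate-stable S with Vec.≡-dec Bool._≟_ (step (iterate N S)) (iterate N S)
  ... | yes stable = stable
  ... | no unstable = ⊥-elim (ℕ.<⇒≱ (ℕ.≤-trans (s≤s (unstable⇒large N S unstable))
          (Subset.p⊂q⇒∣p∣<∣q∣ (unstable⇒⊂ _ unstable))) (Subset.∣p∣≤n (step (iterate N S))))

  closure : Subset N → Subset N
  closure P = iterate N (P ∪ ⁅ ε ⁆)

  iterate-⊆ : ∀ k S → S ⊆ iterate k S
  iterate-⊆ zero S x∈ = x∈
  iterate-⊆ (suc k) S x∈ = ⊆-step _ (iterate-⊆ k S x∈)

  iterate-⊆-⟨⟩ : ∀ P k {x} → x ∈ iterate k (P ∪ ⁅ ε ⁆) → ⟨ P ⟩∋ x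
  iterate-⊆-⟨⟩ P zero {x} x∈ with Subset.x∈p∪q⁻ P ⁅ ε ⁆ x∈
  ... | inj₁ x∈P = gen x∈P
  ... | inj₂ x∈ε rewrite Subset.x∈⁅y⁆⇒x≡y ε x∈ε = idt
  iterate-⊆-⟨⟩ P (suc k) x∈ with ∈-fromDec⁻ (oneStep? _) x∈
  ... | inj₁ x∈′ = iterate-⊆-⟨⟩ P k x∈′
  ... | inj₂ (inj₁ (a , b , a∈ , b∈ , refl)) = mul (iterate-⊆-⟨⟩ P k a∈) (iterate-⊆-⟨⟩ P k b∈)
  ... | inj₂ (inj₂ (a , a∈ , refl)) = inv (iterate-⊆-⟨⟩ P k a∈)

  closure-⊆-⟨⟩ : ∀ P {x} → x ∈ closure P → ⟨ P ⟩∋ x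
  closure-⊆-⟨⟩ P = iterate-⊆-⟨⟩ P N

  ⟨⟩-⊆-closure : ∀ P {x} → ⟨ P ⟩∋ x → x ∈ closure P
  ⟨⟩-⊆-closure P (gen x∈P) = iterate-⊆ N _ (Subset.p⊆p∪q ⁅ ε ⁆ x∈P)
  ⟨⟩-⊆-closure P idt = iterate-⊆ N _ (Subset.q⊆p∪q P ⁅ ε ⁆ (Subset.x∈⁅x⁆ ε))
  ⟨⟩-⊆-closure P (mul p q) = subst (_ ∈_) (iterate-stable _)
    (∈-fromDec⁺ (oneStep? _) (inj₂ (inj₁ (_ , _ , ⟨⟩-⊆-closure P p , ⟨⟩-⊆-closure P q , refl))))
  ⟨⟩-⊆-closure P (inv p) = subst (_ ∈_) (iterate-stable _)
    (∈-fromDec⁺ (oneStep? _) (inj₂ (inj₂ (_ , ⟨⟩-⊆-closure P p , refl))))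

  ⟨_⟩∋? : ∀ P → Decidable (⟨ P ⟩∋_)
  ⟨ P ⟩∋? x with x Subset.∈? closure P
  ... | yes x∈ = yes (closure-⊆-⟨⟩ P x∈)
  ... | no x∉ = no (x∉ ∘ ⟨⟩-⊆-closure P)

  ⟨closure⟩⊆⟨⟩ : ∀ P {x} → ⟨ closure P ⟩∋ x → ⟨ P ⟩∋ x
  ⟨closure⟩⊆⟨⟩ P (gen x∈) = closure-⊆-⟨⟩ P x∈
  ⟨closure⟩⊆⟨⟩ P idt = idt
  ⟨closure⟩⊆⟨⟩ P (mul p q) = mul (⟨closure⟩⊆⟨⟩ P p) (⟨closure⟩⊆⟨⟩ P q)
  ⟨closure⟩⊆⟨⟩ P (inv p) = inv (⟨closure⟩⊆⟨⟩ P p)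

  closure-closed : ∀ P → Closed (closure P)
  closure-closed P x = ⟨⟩-⊆-closure P ∘ ⟨closure⟩⊆⟨⟩ P

  ⊆-closure : ∀ P → P ⊆ closure P
  ⊆-closure P = ⟨⟩-⊆-closure P ∘ gen

module Nim (G : FiniteAbelianGroup) where
  open FiniteAbelianGroup G renaming (order to N; _∙_ to infixl 7 _∙_; _⁻¹ to infix 8 _⁻¹)
  open Span G

  Position : Subset N → Set
  Position = IsPosition G

  position? : ∀ P → Dec (Position P)
  position? P with Fin.all? ⟨ P ⟩∋?
  ... | yes generating = no (λ pos → pos generating)
  ... | no pos = yes pos

  Option : Subset N → Fin N → Set
  Option P g = g ∉ P × Position (P ∪ ⁅ g ⁆)

  option? : ∀ P → Decidable (Option P)
  option? P g = ¬? (g Subset.∈? P) ×-dec position? (P ∪ ⁅ g ⁆)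

  Terminal : Subset N → Set
  Terminal P = Position P × (∀ g → ¬ Option P g)

  terminal-or-option : ∀ {P} → Position P → Terminal P ⊎ ∃ (Option P)
  terminal-or-option {P} pos with Fin.any? (option? P)
  ... | yes option = inj₂ option
  ... | no none = inj₁ (pos , λ g opt → none (g , opt))

  terminal-closed : ∀ {P} → Terminal P → Closed P
  terminal-closed {P} (pos , final) x px with x Subset.∈? P
  ... | yes x∈P = x∈P
  ... | no x∉P = ⊥-elim (final x (x∉P , λ gen-all → pos (λ h → ⟨⟩-absorb px (gen-all h))))

  terminal-maximal : ∀ {P} → Terminal P → ∀ {x} → x ∉ P → ∀ h → ⟨ P ∪ ⁅ x ⁆ ⟩∋ h
  terminal-maximal {P} (_ , final) {x} x∉P with Fin.all? ⟨ P ∪ ⁅ x ⁆ ⟩∋?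
  ... | yes generating = generating
  ... | no pos = ⊥-elim (final x (x∉P , pos))

  module _ {f f′ : Subset N → ℕ} (f-nim : IsNimFunction G f) (f′-nim : IsNimFunction G f′) where
    nim-agree : ∀ k P → N ≤ k + ∣ P ∣ → Position P → f P ≡ f′ P
    option-agree : ∀ k P {g} → N ≤ k + ∣ P ∣ → Option P g → f (P ∪ ⁅ g ⁆) ≡ f′ (P ∪ ⁅ g ⁆)

    nim-agree k P bound pos with ℕ.<-cmp (f P) (f′ P)
    ... | tri≈ _ agree _ = agree
    ... | tri< lt _ _ with proj₂ (f′-nim P pos) (f P) lt
    ...   | g , g∉ , posQ , e =
            ⊥-elim (proj₁ (f-nim P pos) g g∉ posQ (trans (option-agree k P bound (g∉ , posQ)) e))
    nim-agree k P bound pos | tri> _ _ gt with proj₂ (f-nim P pos) (f′ P) gt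
    ...   | g , g∉ , posQ , e =
            ⊥-elim (proj₁ (f′-nim P pos) g g∉ posQ (trans (sym (option-agree k P bound (g∉ , posQ))) e))

    option-agree zero P {g} bound (g∉ , _) = ⊥-elim (ℕ.<⇒≱ (subst (_≤ N) (∣p∪⁅x⁆∣≡1+∣p∣ P g∉) (Subset.∣p∣≤n (P ∪ ⁅ g ⁆))) bound)
    option-agree (suc k) P {g} bound (g∉ , posQ) = nim-agree k (P ∪ ⁅ g ⁆)
      (subst (N ≤_) (trans (sym (ℕ.+-suc k ∣ P ∣)) (cong (k +_) (sym (∣p∪⁅x⁆∣≡1+∣p∣ P g∉)))) bound) posQ

  nimNumber : ∀ {f} → IsNimFunction G f → Position ⊥ → NimNumberIs G (f ⊥)
  nimNumber f-nim pos⊥ = (_ , f-nim) , λ f′ f′-nim → nim-agree f′-nim f-nim N ⊥ (ℕ.m≤m+n N _) pos⊥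

  Reaches : (Subset N → ℕ) → Subset N → ℕ → Set
  Reaches f P v = ∃ λ g → g ∉ P × Position (P ∪ ⁅ g ⁆) × f (P ∪ ⁅ g ⁆) ≡ v

  IsMexAt : (Subset N → ℕ) → Subset N → Set
  IsMexAt f P = (∀ g → g ∉ P → Position (P ∪ ⁅ g ⁆) → f (P ∪ ⁅ g ⁆) ≢ f P) × (∀ v → v < f P → Reaches f P v)

  parity-mex : (𝓕 : Subset N → Set) (f : Subset N → ℕ) (p : ℕ) →
    (∀ {P} → 𝓕 P → f P ≡ parity (∣ P ∣ + p)) →
    (∀ {P g} → 𝓕 P → Option P g → 𝓕 (P ∪ ⁅ g ⁆)) →
    (∀ {P} → 𝓕 P → Terminal P → parity (∣ P ∣ + p) ≡ 0) →
    ∀ {P} → 𝓕 P → Position P → IsMexAt f P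
  parity-mex 𝓕 f p f≡parity 𝓕-closed terminal-even {P} P∈𝓕 pos = differs , reaches
    where
    option-value : ∀ {g} → Option P g → f (P ∪ ⁅ g ⁆) ≡ parity (suc (∣ P ∣ + p))
    option-value {g} opt = trans (f≡parity (𝓕-closed P∈𝓕 opt)) (cong (λ k → parity (k + p)) (∣p∪⁅x⁆∣≡1+∣p∣ P (proj₁ opt)))
    differs : ∀ g → g ∉ P → Position (P ∪ ⁅ g ⁆) → f (P ∪ ⁅ g ⁆) ≢ f P
    differs g g∉ posQ e = parity-suc≢ (∣ P ∣ + p) (trans (sym (option-value (g∉ , posQ))) (trans e (f≡parity P∈𝓕)))
    reaches : ∀ v → v < f P → Reaches f P v
    reaches v v<fP with terminal-or-option pos | subst (v <_) (f≡parity P∈𝓕) v<fP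
    ... | inj₁ terminal | v<parity = ⊥-elim (ℕ.n≮0 (subst (v <_) (terminal-even P∈𝓕 terminal) v<parity))
    ... | inj₂ (g , opt) | v<parity = g , proj₁ opt , proj₂ opt , trans (option-value opt) (parity-suc-< (∣ P ∣ + p) v<parity)

  parity-nim : ∀ p → (∀ P → Terminal P → parity (∣ P ∣ + p) ≡ 0) → IsNimFunction G (λ P → parity (∣ P ∣ + p))
  parity-nim p terminal-even P = parity-mex (λ _ → Unit) _ p (λ _ → refl) (λ _ _ → tt) (λ {P} _ → terminal-even P) tt

module GroupTheory (G : FiniteAbelianGroup) where
  open FiniteAbelianGroup G renaming (order to N; _∙_ to infixl 7 _∙_; _⁻¹ to infix 8 _⁻¹)
  open Span G

  abelianGroup : AbelianGroup 0ℓ 0ℓ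
  abelianGroup = record { isAbelianGroup = isAbelianGroup }

  open AbelianGroup abelianGroup public
    using (assoc; comm; identityˡ; identityʳ; inverseˡ; inverseʳ; commutativeMonoid; commutativeSemigroup)
  open import Algebra.Properties.AbelianGroup abelianGroup public
    using (∙-cancelʳ; ⁻¹-involutive; ε⁻¹≈ε; inverseʳ-unique; ⁻¹-∙-comm)
  open import Algebra.Properties.CommutativeSemigroup commutativeSemigroup public using (interchange)
  open import Algebra.Properties.CommutativeMonoid.Mult commutativeMonoid
    using (×-homo-+; ×-assocˡ; ×-distrib-+) renaming (_×_ to _times_)
  module GroupSum = MonoidSum commutativeMonoid

  infixr 8 _^_
  _^_ : Fin N → ℕ → Fin N
  x ^ n = n times x

  ^-+ : ∀ x m n → x ^ (m + n) ≡ x ^ m ∙ x ^ n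
  ^-+ x = ×-homo-+ x

  ^-* : ∀ x m n → x ^ (m * n) ≡ (x ^ n) ^ m
  ^-* x m n = sym (×-assocˡ x m n)

  ^-∙ : ∀ x y n → (x ∙ y) ^ n ≡ x ^ n ∙ y ^ n
  ^-∙ = ×-distrib-+

  ε^ : ∀ n → ε ^ n ≡ ε
  ε^ zero = refl
  ε^ (suc n) = trans (identityˡ _) (ε^ n)

  ⁻¹-^ : ∀ x n → (x ⁻¹) ^ n ≡ (x ^ n) ⁻¹
  ⁻¹-^ x zero = sym ε⁻¹≈ε
  ⁻¹-^ x (suc n) = trans (cong (x ⁻¹ ∙_) (⁻¹-^ x n)) (⁻¹-∙-comm x (x ^ n))

  ⟨⟩-^ : ∀ {P x} n → ⟨ P ⟩∋ x → ⟨ P ⟩∋ (x ^ n)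
  ⟨⟩-^ zero _ = idt
  ⟨⟩-^ (suc n) px = mul px (⟨⟩-^ n px)

  -- Translation by x permutes G, so Π y = Π (x ∙ y) = x ^ N ∙ Π y.
  ^-order : ∀ x → x ^ N ≡ ε
  ^-order x = ∙-cancelʳ Π (x ^ N) ε (sym (begin
      ε ∙ Π                               ≡⟨ identityˡ Π ⟩
      Π                                   ≡⟨ GroupSum.sum-permute id (permutation (x ∙_) (x ⁻¹ ∙_) x∙x⁻¹∙ x⁻¹∙x∙) ⟩
      GroupSum.sum {N} (x ∙_)             ≡⟨ GroupSum.∑-distrib-+ (λ _ → x) id ⟩
      GroupSum.sum {N} (λ _ → x) ∙ Π      ≡⟨ cong (_∙ Π) (GroupSum.sum-replicate N) ⟩
      x ^ N ∙ Π                           ∎))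
    where
    open ≡-Reasoning
    Π : Fin N
    Π = GroupSum.sum {N} id
    x∙x⁻¹∙ : ∀ y → x ∙ (x ⁻¹ ∙ y) ≡ y
    x∙x⁻¹∙ y = trans (sym (assoc _ _ _)) (trans (cong (_∙ y) (inverseʳ x)) (identityˡ y))
    x⁻¹∙x∙ : ∀ y → x ⁻¹ ∙ (x ∙ y) ≡ y
    x⁻¹∙x∙ y = trans (sym (assoc _ _ _)) (trans (cong (_∙ y) (inverseˡ x)) (identityˡ y))

  ^-mod : ∀ {x} m .{{_ : NonZero m}} → x ^ m ≡ ε → ∀ k → x ^ k ≡ x ^ (k % m)
  ^-mod {x} m xᵐ≡ε k = begin
      x ^ k                                ≡⟨ cong (x ^_) (ℕ.m≡m%n+[m/n]*n k m) ⟩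
      x ^ (k % m + (k ℕ./ m) * m)          ≡⟨ ^-+ x (k % m) _ ⟩
      x ^ (k % m) ∙ x ^ ((k ℕ./ m) * m)    ≡⟨ cong (x ^ (k % m) ∙_) (trans (^-* x (k ℕ./ m) m) (trans (cong (_^ (k ℕ./ m)) xᵐ≡ε) (ε^ (k ℕ./ m)))) ⟩
      x ^ (k % m) ∙ ε                      ≡⟨ identityʳ _ ⟩
      x ^ (k % m)                          ∎
    where open ≡-Reasoning

  Involution : Fin N → Set
  Involution t = t ≢ ε × t ∙ t ≡ ε

  module _ {t} (t∙t≡ε : t ∙ t ≡ ε) where
    ∙-involutive : ∀ x → t ∙ (t ∙ x) ≡ x
    ∙-involutive x = trans (sym (assoc t t x)) (trans (cong (_∙ x) t∙t≡ε) (identityˡ x))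

    ⁻¹-self : t ⁻¹ ≡ t
    ⁻¹-self = sym (inverseʳ-unique t t t∙t≡ε)

    ^-2+ : ∀ j → t ^ (2 + j) ≡ t ^ j
    ^-2+ j = ∙-involutive (t ^ j)

    ^-even : ∀ j → parity j ≡ 0 → t ^ j ≡ ε
    ^-even zero _ = refl
    ^-even (suc (suc j)) e = trans (^-2+ j) (^-even j (trans (sym (parity-2+ j)) e))

    ^-odd : ∀ j → parity j ≡ 1 → t ^ j ≡ t
    ^-odd (suc zero) _ = identityʳ t
    ^-odd (suc (suc j)) e = trans (^-2+ j) (^-odd j (trans (sym (parity-2+ j)) e))

  module _ {P} (closed : Closed P) where
    ε∈ : ε ∈ P
    ε∈ = closed ε idt

    ∙∈ : ∀ {x y} → x ∈ P → y ∈ P → x ∙ y ∈ P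
    ∙∈ x∈ y∈ = closed _ (mul (gen x∈) (gen y∈))

    ⁻¹∈ : ∀ {x} → x ∈ P → x ⁻¹ ∈ P
    ⁻¹∈ x∈ = closed _ (inv (gen x∈))

    ⁻¹∈⁻ : ∀ {x} → x ⁻¹ ∈ P → x ∈ P
    ⁻¹∈⁻ {x} x⁻¹∈ = subst (_∈ P) (⁻¹-involutive x) (⁻¹∈ x⁻¹∈)

    -- Pair each non-identity element of P with its inverse.
    closed-odd : (∀ {x} → x ∈ P → x ∙ x ≡ ε → x ≡ ε) → parity ∣ P ∣ ≡ 1
    closed-odd no-involution = begin
        parity ∣ P ∣                                  ≡⟨ cong parity (trans (∣p∣≡count P) (count-split ∈P isε)) ⟩
        parity (count (λ x → ∈P x ∧ isε x) + count q) ≡⟨ cong parity (cong₂ _+_ (trans (count-cong only-ε) (count-≡ ε)) pairs) ⟩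
        parity (1 + (k + k))                          ≡⟨ parity-suc-0 (k + k) (parity-double k) ⟩
        1                                             ∎
      where
      open ≡-Reasoning
      ∈P isε : Fin N → Bool
      ∈P x = does (x Subset.∈? P)
      isε x = does (x Fin.≟ ε)
      only-ε : ∀ x → (∈P x ∧ isε x) ≡ isε x
      only-ε x with x Fin.≟ ε
      ... | yes refl = trans (Bool.∧-identityʳ _) (dec-true (ε Subset.∈? P) ε∈)
      ... | no _ = Bool.∧-zeroʳ (∈P x)
      Q? : Decidable (λ x → x ∈ P × x ≢ ε)
      Q? x = (x Subset.∈? P) ×-dec ¬? (x Fin.≟ ε)
      q : Fin N → Bool
      q = does ∘ Q?
      k : ℕ
      k = count (λ x → q x ∧ (x <ᵇ x ⁻¹))
      ⁻¹≡ε⇒≡ε : ∀ {x} → x ⁻¹ ≡ ε → x ≡ ε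
      ⁻¹≡ε⇒≡ε {x} e = trans (sym (⁻¹-involutive x)) (trans (cong _⁻¹ e) ε⁻¹≈ε)
      pairs : count q ≡ k + k
      pairs = count-involution _⁻¹ ⁻¹-involutive q
        (λ x → does-⇔ (mk⇔ (λ (x⁻¹∈ , x⁻¹≢ε) → ⁻¹∈⁻ x⁻¹∈ , λ x≡ε → x⁻¹≢ε (trans (cong _⁻¹ x≡ε) ε⁻¹≈ε))
                            (λ (x∈ , x≢ε) → ⁻¹∈ x∈ , x≢ε ∘ ⁻¹≡ε⇒≡ε)) (Q? (x ⁻¹)) (Q? x))
        (λ x qx x⁻¹≡x → let (x∈ , x≢ε) = does⇒ (Q? x) qx in
          x≢ε (no-involution x∈ (trans (cong (x ∙_) (sym x⁻¹≡x)) (inverseʳ x))))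

    -- Translation by an involution t ∈ P pairs the elements of P.
    closed-even : ∀ {t} → t ∈ P → Involution t → parity ∣ P ∣ ≡ 0
    closed-even {t} t∈ (t≢ε , t∙t≡ε) = begin
        parity ∣ P ∣     ≡⟨ cong parity (trans (∣p∣≡count P) (count-involution (t ∙_) (∙-involutive t∙t≡ε) ∈P invariant fixed-point-free)) ⟩
        parity (k + k)   ≡⟨ parity-double k ⟩
        0                ∎
      where
      open ≡-Reasoning
      ∈P : Fin N → Bool
      ∈P x = does (x Subset.∈? P)
      k : ℕ
      k = count (λ x → ∈P x ∧ (x <ᵇ t ∙ x))
      invariant : ∀ x → ∈P (t ∙ x) ≡ ∈P x
      invariant x = does-⇔ (mk⇔ (λ tx∈ → subst (_∈ P) (∙-involutive t∙t≡ε x) (∙∈ t∈ tx∈)) (∙∈ t∈)) ((t ∙ x) Subset.∈? P) (x Subset.∈? P)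
      fixed-point-free : ∀ x → ∈P x ≡ true → t ∙ x ≢ x
      fixed-point-free x _ tx≡x = t≢ε (∙-cancelʳ x t ε (trans tx≡x (sym (identityˡ x))))

  ⊤-closed : Closed ⊤
  ⊤-closed _ _ = Subset.∈⊤

  involution-exists : parity N ≡ 0 → ∃ Involution
  involution-exists even with Fin.any? (λ t → ¬? (t Fin.≟ ε) ×-dec (t ∙ t Fin.≟ ε))
  ... | yes found = found
  ... | no none = ⊥-elim (ℕ.0≢1+n (trans (sym even) (trans (cong parity (sym (Subset.∣⊤∣≡n N))) odd)))
    where
    odd : parity ∣ ⊤ {N} ∣ ≡ 1
    odd = closed-odd ⊤-closed λ {x} _ x∙x≡ε → decidable-stable (x Fin.≟ ε) (λ x≢ε → none (x , x≢ε , x∙x≡ε))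

  coset-split : ∀ {P t} → Closed P → t ∙ t ≡ ε → ∀ {h} → ⟨ P ∪ ⁅ t ⁆ ⟩∋ h → h ∈ P ⊎ t ∙ h ∈ P
  coset-split {P} {t} closed t∙t≡ε = split
    where
    split : ∀ {h} → ⟨ P ∪ ⁅ t ⁆ ⟩∋ h → h ∈ P ⊎ t ∙ h ∈ P
    split (gen h∈) with Subset.x∈p∪q⁻ P ⁅ t ⁆ h∈
    ... | inj₁ h∈P = inj₁ h∈P
    ... | inj₂ h∈t rewrite Subset.x∈⁅y⁆⇒x≡y t h∈t = inj₂ (subst (_∈ P) (sym t∙t≡ε) (ε∈ closed))
    split idt = inj₁ (ε∈ closed)
    split (mul {a} {b} p q) with split p | split q
    ... | inj₁ a∈ | inj₁ b∈ = inj₁ (∙∈ closed a∈ b∈)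
    ... | inj₁ a∈ | inj₂ tb∈ = inj₂ (subst (_∈ P) (trans (sym (assoc a t b)) (trans (cong (_∙ b) (comm a t)) (assoc t a b))) (∙∈ closed a∈ tb∈))
    ... | inj₂ ta∈ | inj₁ b∈ = inj₂ (subst (_∈ P) (assoc t a b) (∙∈ closed ta∈ b∈))
    ... | inj₂ ta∈ | inj₂ tb∈ = inj₁ (subst (_∈ P) (trans (interchange t a t b) (trans (cong (_∙ (a ∙ b)) t∙t≡ε) (identityˡ _))) (∙∈ closed ta∈ tb∈))
    split (inv {a} p) with split p
    ... | inj₁ a∈ = inj₁ (⁻¹∈ closed a∈)
    ... | inj₂ ta∈ = inj₂ (subst (_∈ P) (trans (sym (⁻¹-∙-comm t a)) (cong (_∙ a ⁻¹) (⁻¹-self t∙t≡ε))) (⁻¹∈ closed ta∈))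

  -- Translation by t swaps P and its complement.
  index-two : ∀ {P t} → Closed P → t ∙ t ≡ ε → t ∉ P → (∀ h → ⟨ P ∪ ⁅ t ⁆ ⟩∋ h) → N ≡ ∣ P ∣ + ∣ P ∣
  index-two {P} {t} closed t∙t≡ε t∉P generating = begin
      N                               ≡⟨ count-true N ⟨
      count {N} (λ _ → true)          ≡⟨ count-split (λ _ → true) ∈P ⟩
      count ∈P + count (not ∘ ∈P)     ≡⟨ cong (count ∈P +_) (trans (count-cong swap) (sym (count-permute (t ∙_) (∙-involutive t∙t≡ε) ∈P))) ⟩
      count ∈P + count ∈P             ≡⟨ cong₂ _+_ (∣p∣≡count P) (∣p∣≡count P) ⟨
      ∣ P ∣ + ∣ P ∣                   ∎
    where
    open ≡-Reasoning
    ∈P : Fin N → Bool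
    ∈P x = does (x Subset.∈? P)
    swap : ∀ x → not (∈P x) ≡ ∈P (t ∙ x)
    swap x = does-⇔ (mk⇔ to from) (¬? (x Subset.∈? P)) ((t ∙ x) Subset.∈? P)
      where
      to : x ∉ P → t ∙ x ∈ P
      to x∉ with coset-split closed t∙t≡ε (generating x)
      ... | inj₁ x∈ = ⊥-elim (x∉ x∈)
      ... | inj₂ tx∈ = tx∈
      from : t ∙ x ∈ P → x ∉ P
      from tx∈ x∈ = t∉P (subst (_∈ P) (trans (assoc t x (x ⁻¹)) (trans (cong (t ∙_) (inverseʳ x)) (identityʳ t))) (∙∈ closed tx∈ (⁻¹∈ closed x∈)))

  -- Two distinct involutions t, s would make 4 divide N: s permutes the t-orbits {x, t x} without
  -- fixed points, and τ transports this action to the orbit representatives {x ∣ x < t x}.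
  involution-unique : ∀ m → N ≡ m + m → parity m ≡ 1 → ∀ {t s} → Involution t → Involution s → t ≡ s
  involution-unique m N≡2m odd {t} {s} (t≢ε , t∙t≡ε) (s≢ε , s∙s≡ε) with t Fin.≟ s
  ... | yes t≡s = t≡s
  ... | no t≢s = ⊥-elim (ℕ.0≢1+n (trans (sym even) odd))
    where
    tx≢x : ∀ x → t ∙ x ≢ x
    tx≢x x tx≡x = t≢ε (∙-cancelʳ x t ε (trans tx≡x (sym (identityˡ x))))
    A : Fin N → Bool
    A x = x <ᵇ t ∙ x
    A-t : ∀ x → A (t ∙ x) ≡ not (A x)
    A-t x = trans (cong (t ∙ x <ᵇ_) (∙-involutive t∙t≡ε x)) (<ᵇ-flip (tx≢x x ∘ sym))
    count-A : count A ≡ m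
    count-A = double-injective _ _ (trans (sym (count-involution (t ∙_) (∙-involutive t∙t≡ε) (λ _ → true) (λ _ → refl) (λ x _ → tx≢x x)))
      (trans (count-true N) N≡2m))
    τ : Fin N → Fin N
    τ x = if A x then (if A (s ∙ x) then s ∙ x else t ∙ (s ∙ x)) else x
    s∙t∙s∙ : ∀ x → s ∙ (t ∙ (s ∙ x)) ≡ t ∙ x
    s∙t∙s∙ x = trans (sym (assoc s t (s ∙ x))) (trans (cong (_∙ (s ∙ x)) (comm s t)) (trans (assoc t s (s ∙ x)) (cong (t ∙_) (∙-involutive s∙s≡ε x))))
    τ-A : ∀ x → A (τ x) ≡ A x
    τ-A x with A x in ax
    ... | false = ax
    ... | true with A (s ∙ x) in asx
    ...   | true = asx
    ...   | false = trans (A-t (s ∙ x)) (cong not asx)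
    τ-involutive : ∀ x → τ (τ x) ≡ x
    τ-involutive x with A x in ax
    ... | false rewrite ax = refl
    ... | true with A (s ∙ x) in asx
    ...   | true rewrite asx | ∙-involutive s∙s≡ε x | ax = refl
    ...   | false rewrite trans (A-t (s ∙ x)) (cong not asx) | s∙t∙s∙ x | trans (A-t x) (cong not ax) = ∙-involutive t∙t≡ε x
    τ-fixed-point-free : ∀ x → A x ≡ true → τ x ≢ x
    τ-fixed-point-free x ax τx≡x with A x | ax
    ... | true | _ with A (s ∙ x)
    ...   | true = s≢ε (∙-cancelʳ x s ε (trans τx≡x (sym (identityˡ x))))
    ...   | false = t≢s (sym (trans (inverseʳ-unique t s (∙-cancelʳ x (t ∙ s) ε (trans (trans (assoc t s x) τx≡x) (sym (identityˡ x))))) (⁻¹-self t∙t≡ε)))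
    even : parity m ≡ 0
    even = trans (cong parity (trans (sym count-A) (count-involution τ τ-involutive A τ-A τ-fixed-point-free))) (parity-double (count (λ x → A x ∧ (x <ᵇ τ x))))

  ⟨∅⟩∋⇒≡ε : ∀ {x} → ⟨ ⊥ ⟩∋ x → x ≡ ε
  ⟨∅⟩∋⇒≡ε (gen x∈) = ⊥-elim (Subset.∉⊥ x∈)
  ⟨∅⟩∋⇒≡ε idt = refl
  ⟨∅⟩∋⇒≡ε (mul p q) rewrite ⟨∅⟩∋⇒≡ε p | ⟨∅⟩∋⇒≡ε q = identityˡ ε
  ⟨∅⟩∋⇒≡ε (inv p) rewrite ⟨∅⟩∋⇒≡ε p = ε⁻¹≈ε

  module _ {A : Set} {_⊕_ : A → A → A} (enum : Fin N ↔ A) where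
    open Inverse enum using (to; from; strictlyInverseˡ; strictlyInverseʳ)

    surjective-hom⇒iso : (ψ : A → Fin N) → (∀ a b → ψ (a ⊕ b) ≡ ψ a ∙ ψ b) → (∀ x → ∃ λ a → ψ a ≡ x) → IsoTo G A _⊕_
    surjective-hom⇒iso ψ ψ-hom ψ-surj = φ , (φ-injective , φ-surjective) , φ-hom
      where
      ψ-injective : Injective _≡_ _≡_ ψ
      ψ-injective {a} {b} e = begin
          a            ≡⟨ strictlyInverseˡ a ⟨
          to (from a)  ≡⟨ cong to (surjective⇒injective ψ∘to-surjective ψ∘to-e) ⟩
          to (from b)  ≡⟨ strictlyInverseˡ b ⟩
          b            ∎
        where
        open ≡-Reasoning
        ψ∘to-surjective : ∀ x → ∃ λ y → ψ (to y) ≡ x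
        ψ∘to-surjective x = from (proj₁ (ψ-surj x)) , trans (cong ψ (strictlyInverseˡ _)) (proj₂ (ψ-surj x))
        ψ∘to-e : ψ (to (from a)) ≡ ψ (to (from b))
        ψ∘to-e = trans (cong ψ (strictlyInverseˡ a)) (trans e (cong ψ (sym (strictlyInverseˡ b))))
      φ : Fin N → A
      φ x = proj₁ (ψ-surj x)
      ψ∘φ : ∀ x → ψ (φ x) ≡ x
      ψ∘φ x = proj₂ (ψ-surj x)
      φ-injective : Injective _≡_ _≡_ φ
      φ-injective {x} {y} e = trans (sym (ψ∘φ x)) (trans (cong ψ e) (ψ∘φ y))
      φ-surjective : ∀ a → ∃ λ x → ∀ {z} → z ≡ x → φ z ≡ a
      φ-surjective a = ψ a , λ { refl → ψ-injective (ψ∘φ (ψ a)) }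
      φ-hom : ∀ x y → φ (x ∙ y) ≡ φ x ⊕ φ y
      φ-hom x y = ψ-injective (trans (ψ∘φ (x ∙ y)) (sym (trans (ψ-hom (φ x) (φ y)) (cong₂ _∙_ (ψ∘φ x) (ψ∘φ y)))))

  iso-order : ∀ {A : Set} {_⊕_ : A → A → A} {k} → IsoTo G A _⊕_ → Fin k ↔ A → N ≡ k
  iso-order {A} {k = k} (φ , (φ-injective , φ-surjective) , _) enum =
    Fin.cantor-schröder-bernstein {f = from ∘ φ} {g = φ⁻¹ ∘ to} from∘φ-injective φ⁻¹∘to-injective
    where
    open Inverse enum using (to; from; strictlyInverseˡ; strictlyInverseʳ)
    φ⁻¹ : A → Fin N
    φ⁻¹ a = proj₁ (φ-surjective a)
    φ∘φ⁻¹ : ∀ a → φ (φ⁻¹ a) ≡ a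
    φ∘φ⁻¹ a = proj₂ (φ-surjective a) refl
    from∘φ-injective : Injective _≡_ _≡_ (from ∘ φ)
    from∘φ-injective e = φ-injective (trans (sym (strictlyInverseˡ _)) (trans (cong to e) (strictlyInverseˡ _)))
    φ⁻¹∘to-injective : Injective _≡_ _≡_ (φ⁻¹ ∘ to)
    φ⁻¹∘to-injective {y} {y′} e = trans (sym (strictlyInverseʳ y))
      (trans (cong from (trans (sym (φ∘φ⁻¹ (to y))) (trans (cong φ e) (φ∘φ⁻¹ (to y′))))) (strictlyInverseʳ y′))

  module _ {d} .{{_ : NonZero d}} (χ : Fin N → Fin d) (χ-hom : ∀ x y → χ (x ∙ y) ≡ addℤ d (χ x) (χ y)) where
    toℕ-hom-ε : toℕ (χ ε) ≡ 0
    toℕ-hom-ε = addℤ-idem⇒zero d (χ ε) (sym (trans (cong χ (sym (identityˡ ε))) (χ-hom ε ε)))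

    toℕ-hom-^ : ∀ x j → toℕ (χ (x ^ j)) ≡ (j * toℕ (χ x)) % d
    toℕ-hom-^ x zero = trans toℕ-hom-ε (sym (ℕ.m*n%n≡0 0 d))
    toℕ-hom-^ x (suc j) = begin
      toℕ (χ (x ∙ x ^ j))                      ≡⟨ cong toℕ (χ-hom x (x ^ j)) ⟩
      toℕ (addℤ d (χ x) (χ (x ^ j)))           ≡⟨ toℕ-addℤ d (χ x) (χ (x ^ j)) ⟩
      (toℕ (χ x) + toℕ (χ (x ^ j))) % d        ≡⟨ cong (λ n → (toℕ (χ x) + n) % d) (toℕ-hom-^ x j) ⟩
      (toℕ (χ x) + (j * toℕ (χ x)) % d) % d    ≡⟨ [m+n%d]%d≡[m+n]%d (toℕ (χ x)) (j * toℕ (χ x)) d ⟩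
      (suc j * toℕ (χ x)) % d                  ∎
      where open ≡-Reasoning

  ⟨⁅x⁆⟩∋⇒power : ∀ {x y} → ⟨ ⊥ ∪ ⁅ x ⁆ ⟩∋ y → ∃ λ k → x ^ k ≡ y
  ⟨⁅x⁆⟩∋⇒power {x} (gen y∈) with Subset.x∈p∪q⁻ ⊥ ⁅ x ⁆ y∈
  ... | inj₁ y∈⊥ = ⊥-elim (Subset.∉⊥ y∈⊥)
  ... | inj₂ y∈x = 1 , trans (identityʳ x) (sym (Subset.x∈⁅y⁆⇒x≡y x y∈x))
  ⟨⁅x⁆⟩∋⇒power idt = 0 , refl
  ⟨⁅x⁆⟩∋⇒power {x} (mul p q) with ⟨⁅x⁆⟩∋⇒power p | ⟨⁅x⁆⟩∋⇒power q
  ... | k , xᵏ≡a | l , xˡ≡b = k + l , trans (^-+ x k l) (cong₂ _∙_ xᵏ≡a xˡ≡b)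
  ⟨⁅x⁆⟩∋⇒power {x} (inv p) with ⟨⁅x⁆⟩∋⇒power p
  ... | k , xᵏ≡a = k * ℕ.pred N , trans (^-* x k (ℕ.pred N)) (trans (cong (_^ k) x^[N-1]≡x⁻¹)
                    (trans (⁻¹-^ x k) (cong _⁻¹ xᵏ≡a)))
    where
    instance
      N-nonZero : NonZero N
      N-nonZero = ℕ.>-nonZero (ℕ.≤-trans (s≤s z≤n) (Fin.toℕ<n ε))
    x^[N-1]≡x⁻¹ : x ^ ℕ.pred N ≡ x ⁻¹
    x^[N-1]≡x⁻¹ = inverseʳ-unique x _ (trans (cong (x ^_) (ℕ.suc-pred N)) (^-order x))

module ParityCases (G : FiniteAbelianGroup) where
  open FiniteAbelianGroup G renaming (order to N; _∙_ to infixl 7 _∙_; _⁻¹ to infix 8 _⁻¹)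
  open Span G
  open Nim G
  open GroupTheory G

  position-∅ : 2 ≤ N → Position ⊥
  position-∅ 2≤N generating = ℕ.<⇒≱ 2≤N (ℕ.≤-trans (Fin.injective⇒≤ const-injective) (s≤s z≤n))
    where
    const-injective : Injective _≡_ _≡_ (λ (_ : Fin N) → fzero {0})
    const-injective {x} {y} _ = trans (⟨∅⟩∋⇒≡ε (generating x)) (sym (⟨∅⟩∋⇒≡ε (generating y)))

  nimNumber-∅ : ∀ {v} p → 2 ≤ N → (∀ P → Terminal P → parity (∣ P ∣ + p) ≡ 0) → parity p ≡ v → NimNumberIs G v
  nimNumber-∅ {v} p 2≤N terminal-even e = subst (NimNumberIs G) (trans (cong (λ k → parity (k + p)) (Subset.∣⊥∣≡0 N)) e)
    (nimNumber (parity-nim p terminal-even) (position-∅ 2≤N))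

  odd-order-nim : 2 ≤ N → parity N ≡ 1 → NimNumberIs G 1
  odd-order-nim 2≤N odd = nimNumber-∅ 1 2≤N terminal-odd refl
    where
    no-involution : ∀ {x} → x ∙ x ≡ ε → x ≡ ε
    no-involution {x} x∙x≡ε = decidable-stable (x Fin.≟ ε) λ x≢ε →
      ℕ.0≢1+n (trans (sym (closed-even ⊤-closed Subset.∈⊤ (x≢ε , x∙x≡ε))) (trans (cong parity (Subset.∣⊤∣≡n N)) odd))
    terminal-odd : ∀ P → Terminal P → parity (∣ P ∣ + 1) ≡ 0
    terminal-odd P terminal = trans (cong parity (ℕ.+-comm ∣ P ∣ 1))
      (parity-suc-1 ∣ P ∣ (closed-odd (terminal-closed terminal) (λ _ → no-involution)))

  doubly-even-nim : 2 ≤ N → parity N ≡ 0 → (∀ c → N ≡ c + c → parity c ≡ 0) → NimNumberIs G 0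
  doubly-even-nim 2≤N even half-even = nimNumber-∅ 0 2≤N terminal-even refl
    where
    terminal-even : ∀ P → Terminal P → parity (∣ P ∣ + 0) ≡ 0
    terminal-even P terminal with involution-exists even | terminal-closed terminal
    ... | t , t-inv | closed with t Subset.∈? P
    ...   | yes t∈ = trans (cong parity (ℕ.+-identityʳ ∣ P ∣)) (closed-even closed t∈ t-inv)
    ...   | no t∉ = trans (cong parity (ℕ.+-identityʳ ∣ P ∣))
                (half-even ∣ P ∣ (index-two closed (proj₂ t-inv) t∉ (terminal-maximal terminal t∉)))

-- G ≅ H × ℤ₂ with H = {x ∣ x ^ m ≡ ε} of odd order m.
module TwiceOdd (G : FiniteAbelianGroup) (m : ℕ) (N≡2m : FiniteAbelianGroup.order G ≡ m + m) (m-odd : parity m ≡ 1) where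
  open FiniteAbelianGroup G renaming (order to N; _∙_ to infixl 7 _∙_; _⁻¹ to infix 8 _⁻¹)
  open Span G
  open Nim G
  open GroupTheory G

  t₀-involution : ∃ Involution
  t₀-involution = involution-exists (trans (cong parity N≡2m) (parity-double m))

  t₀ : Fin N
  t₀ = proj₁ t₀-involution

  t₀∙t₀≡ε : t₀ ∙ t₀ ≡ ε
  t₀∙t₀≡ε = proj₂ (proj₂ t₀-involution)

  t₀²≡ε : t₀ ^ 2 ≡ ε
  t₀²≡ε = trans (cong (t₀ ∙_) (identityʳ t₀)) t₀∙t₀≡ε

  involution⇒≡t₀ : ∀ {s} → Involution s → s ≡ t₀
  involution⇒≡t₀ s-inv = involution-unique m N≡2m m-odd s-inv (proj₂ t₀-involution)

  H : Subset N
  H = fromDec (λ x → x ^ m Fin.≟ ε)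

  ∈H⁻ : ∀ {x} → x ∈ H → x ^ m ≡ ε
  ∈H⁻ = ∈-fromDec⁻ (λ x → x ^ m Fin.≟ ε)

  ∈H⁺ : ∀ {x} → x ^ m ≡ ε → x ∈ H
  ∈H⁺ = ∈-fromDec⁺ (λ x → x ^ m Fin.≟ ε)

  H-closed : Closed H
  H-closed x p = ∈H⁺ (power p)
    where
    power : ∀ {x} → ⟨ H ⟩∋ x → x ^ m ≡ ε
    power (gen x∈) = ∈H⁻ x∈
    power idt = ε^ m
    power (mul {a} {b} p q) = trans (^-∙ a b m) (trans (cong₂ _∙_ (power p) (power q)) (identityˡ ε))
    power (inv {a} p) = trans (⁻¹-^ a m) (trans (cong _⁻¹ (power p)) ε⁻¹≈ε)

  ⟨⟩⊆H : ∀ {P} → P ⊆ H → ∀ {y} → ⟨ P ⟩∋ y → y ∈ H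
  ⟨⟩⊆H P⊆H p = H-closed _ (⟨⟩-mono P⊆H p)

  t₀∉H : t₀ ∉ H
  t₀∉H t₀∈ = proj₁ (proj₂ t₀-involution) (trans (sym (^-odd t₀∙t₀≡ε m m-odd)) (∈H⁻ t₀∈))

  ∉H⇒^m-involution : ∀ {x} → x ∉ H → Involution (x ^ m)
  ∉H⇒^m-involution {x} x∉ = x∉ ∘ ∈H⁺ , trans (sym (^-+ x m m)) (trans (cong (x ^_) (sym N≡2m)) (^-order x))

  ∉H⇒t₀∙∈H : ∀ {x} → x ∉ H → t₀ ∙ x ∈ H
  ∉H⇒t₀∙∈H {x} x∉ = ∈H⁺ (trans (^-∙ t₀ x m)
    (trans (cong₂ _∙_ (^-odd t₀∙t₀≡ε m m-odd) (involution⇒≡t₀ (∉H⇒^m-involution x∉))) t₀∙t₀≡ε))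

  H-no-involution : ∀ {x} → x ∈ H → x ∙ x ≡ ε → x ≡ ε
  H-no-involution x∈ x∙x≡ε = trans (sym (^-odd x∙x≡ε m m-odd)) (∈H⁻ x∈)

  ⊆H⇒position : ∀ {Q} → Q ⊆ H → Position Q
  ⊆H⇒position Q⊆H generating = t₀∉H (⟨⟩⊆H Q⊆H (generating t₀))

  terminal-⊆H⇒odd : ∀ {P} → Terminal P → P ⊆ H → parity ∣ P ∣ ≡ 1
  terminal-⊆H⇒odd terminal P⊆H = closed-odd (terminal-closed terminal) (H-no-involution ∘ P⊆H)

  terminal-⊈H⇒even : ∀ {P} → Terminal P → ¬ P ⊆ H → parity ∣ P ∣ ≡ 0
  terminal-⊈H⇒even {P} terminal P⊈H with ¬∀⇒∃¬ (Subset._∈? P) (Subset._∈? H) P⊈H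
  ... | x , x∈ , x∉ = closed-even (terminal-closed terminal)
    (terminal-closed terminal _ (⟨⟩-^ m (gen x∈))) (∉H⇒^m-involution x∉)

  SpansH : Subset N → Set
  SpansH P = ∀ y → y ∈ H → ⟨ P ⟩∋ y

  spansH? : ∀ P → Dec (SpansH P)
  spansH? P with Fin.all? (λ y → (y Subset.∈? H) →-dec ⟨ P ⟩∋? y)
  ... | yes all = yes all
  ... | no ¬all = no ¬all

  OneShortOfH : Subset N → Set
  OneShortOfH P = ∃ λ h → h ∉ P × h ∈ H × SpansH (P ∪ ⁅ h ⁆)

  oneShortOfH? : ∀ P → Dec (OneShortOfH P)
  oneShortOfH? P = Fin.any? (λ h → ¬? (h Subset.∈? P) ×-dec (h Subset.∈? H) ×-dec spansH? (P ∪ ⁅ h ⁆))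

  -- G = H ∪ t₀ H, and t₀ ∙ h ∙ (t₀ ∙ g)⁻¹ ∙ g = h.
  spansH⇒∪∉H-spans-G : ∀ {P g} → SpansH P → g ∉ H → ∀ h → ⟨ P ∪ ⁅ g ⁆ ⟩∋ h
  spansH⇒∪∉H-spans-G {P} {g} spans g∉ h with h Subset.∈? H
  ... | yes h∈ = ⟨⟩-∪ˡ ⁅ g ⁆ (spans h h∈)
  ... | no h∉ = subst (⟨ P ∪ ⁅ g ⁆ ⟩∋_) t₀h∙[t₀g]⁻¹∙g≡h
      (mul (mul (⟨⟩-∪ˡ ⁅ g ⁆ (spans _ (∉H⇒t₀∙∈H h∉))) (inv (⟨⟩-∪ˡ ⁅ g ⁆ (spans _ (∉H⇒t₀∙∈H g∉))))) (⟨⟩-∪-⁅⁆ P g))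
    where
    open ≡-Reasoning
    t₀h∙[t₀g]⁻¹∙g≡h : t₀ ∙ h ∙ (t₀ ∙ g) ⁻¹ ∙ g ≡ h
    t₀h∙[t₀g]⁻¹∙g≡h = begin
      t₀ ∙ h ∙ (t₀ ∙ g) ⁻¹ ∙ g       ≡⟨ cong (λ z → t₀ ∙ h ∙ z ∙ g) (trans (sym (⁻¹-∙-comm t₀ g)) (cong (_∙ g ⁻¹) (⁻¹-self t₀∙t₀≡ε))) ⟩
      t₀ ∙ h ∙ (t₀ ∙ g ⁻¹) ∙ g       ≡⟨ cong (_∙ g) (interchange t₀ h t₀ (g ⁻¹)) ⟩
      t₀ ∙ t₀ ∙ (h ∙ g ⁻¹) ∙ g       ≡⟨ cong (λ z → z ∙ (h ∙ g ⁻¹) ∙ g) t₀∙t₀≡ε ⟩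
      ε ∙ (h ∙ g ⁻¹) ∙ g             ≡⟨ cong (_∙ g) (identityˡ _) ⟩
      h ∙ g ⁻¹ ∙ g                   ≡⟨ assoc h (g ⁻¹) g ⟩
      h ∙ (g ⁻¹ ∙ g)                 ≡⟨ cong (h ∙_) (inverseˡ g) ⟩
      h ∙ ε                          ≡⟨ identityʳ h ⟩
      h                              ∎

  -- ⟨ P ∪ {t₀} ⟩ = ⟨ P ⟩ ∪ t₀ ⟨ P ⟩ misses the elements of H outside ⟨ P ⟩.
  ¬spansH⇒t₀-option : ∀ {P} → P ⊆ H → ¬ SpansH P → Option P t₀
  ¬spansH⇒t₀-option {P} P⊆H ¬spans = t₀∉H ∘ P⊆H , position
    where
    missing : ∃ λ y → y ∈ H × ¬ ⟨ P ⟩∋ y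
    missing = ¬∀⇒∃¬ (Subset._∈? H) ⟨ P ⟩∋? (λ all → ¬spans (λ y → all))
    y : Fin N
    y = proj₁ missing
    position : Position (P ∪ ⁅ t₀ ⁆)
    position generating with coset-split (closure-closed P) t₀∙t₀≡ε
                               (⟨⟩-mono (∪-monoˡ ⁅ t₀ ⁆ (⊆-closure P)) (generating y))
    ... | inj₁ y∈ = proj₂ (proj₂ missing) (closure-⊆-⟨⟩ P y∈)
    ... | inj₂ t₀y∈ = t₀∉H (subst (_∈ H) (trans (assoc t₀ y (y ⁻¹)) (trans (cong (t₀ ∙_) (inverseʳ y)) (identityʳ t₀)))
        (∙∈ H-closed (⟨⟩⊆H P⊆H (closure-⊆-⟨⟩ P t₀y∈)) (⁻¹∈ H-closed (proj₁ (proj₂ missing)))))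

  data Class (P : Subset N) : Set where
    notInH      : ¬ P ⊆ H → Class P
    spansH      : P ⊆ H → SpansH P → Class P
    oneShortOfH : P ⊆ H → ¬ SpansH P → OneShortOfH P → Class P
    farFromH    : P ⊆ H → ¬ SpansH P → ¬ OneShortOfH P → Class P

  classify : ∀ P → Class P
  classify P with P Subset.⊆? H | spansH? P | oneShortOfH? P
  ... | no P⊈H | _ | _ = notInH P⊈H
  ... | yes P⊆H | yes spans | _ = spansH P⊆H spans
  ... | yes P⊆H | no ¬spans | yes short = oneShortOfH P⊆H ¬spans short
  ... | yes P⊆H | no ¬spans | no ¬short = farFromH P⊆H ¬spans ¬short

  classValue : ∀ {P} → Class P → ℕ
  classValue {P} (notInH _) = parity ∣ P ∣
  classValue {P} (spansH _ _) = parity (suc ∣ P ∣)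
  classValue {P} (oneShortOfH _ _ _) = 2 + parity (suc ∣ P ∣)
  classValue {P} (farFromH _ _ _) = parity ∣ P ∣

  value : Subset N → ℕ
  value P = classValue (classify P)

  value-notInH : ∀ {P} → ¬ P ⊆ H → value P ≡ parity ∣ P ∣
  value-notInH {P} P⊈H with classify P
  ... | notInH _ = refl
  ... | spansH P⊆H _ = ⊥-elim (P⊈H P⊆H)
  ... | oneShortOfH P⊆H _ _ = ⊥-elim (P⊈H P⊆H)
  ... | farFromH P⊆H _ _ = ⊥-elim (P⊈H P⊆H)

  value-spansH : ∀ {P} → P ⊆ H → SpansH P → value P ≡ parity (suc ∣ P ∣)
  value-spansH {P} P⊆H spans with classify P
  ... | notInH P⊈H = ⊥-elim (P⊈H P⊆H)
  ... | spansH _ _ = refl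
  ... | oneShortOfH _ ¬spans _ = ⊥-elim (¬spans spans)
  ... | farFromH _ ¬spans _ = ⊥-elim (¬spans spans)

  value-oneShortOfH : ∀ {P} → P ⊆ H → ¬ SpansH P → OneShortOfH P → value P ≡ 2 + parity (suc ∣ P ∣)
  value-oneShortOfH {P} P⊆H ¬spans short with classify P
  ... | notInH P⊈H = ⊥-elim (P⊈H P⊆H)
  ... | spansH _ spans = ⊥-elim (¬spans spans)
  ... | oneShortOfH _ _ _ = refl
  ... | farFromH _ _ ¬short = ⊥-elim (¬short short)

  value-farFromH : ∀ {P} → P ⊆ H → ¬ SpansH P → ¬ OneShortOfH P → value P ≡ parity ∣ P ∣
  value-farFromH {P} P⊆H ¬spans ¬short with classify P
  ... | notInH P⊈H = ⊥-elim (P⊈H P⊆H)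
  ... | spansH _ spans = ⊥-elim (¬spans spans)
  ... | oneShortOfH _ _ short = ⊥-elim (¬short short)
  ... | farFromH _ _ _ = refl

  value-≤1⊎oneShortOfH : ∀ Q → value Q ≤ 1 ⊎ value Q ≡ 2 + parity (suc ∣ Q ∣)
  value-≤1⊎oneShortOfH Q with classify Q
  ... | notInH _ = inj₁ (parity≤1 ∣ Q ∣)
  ... | spansH _ _ = inj₁ (parity≤1 (suc ∣ Q ∣))
  ... | oneShortOfH _ _ _ = inj₂ refl
  ... | farFromH _ _ _ = inj₁ (parity≤1 ∣ Q ∣)

  t₀-reaches : ∀ {P} → P ⊆ H → ¬ SpansH P → Reaches value P (parity (suc ∣ P ∣))
  t₀-reaches {P} P⊆H ¬spans with ¬spansH⇒t₀-option P⊆H ¬spans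
  ... | t₀∉P , position = t₀ , t₀∉P , position ,
    trans (value-notInH (λ Q⊆H → t₀∉H (Q⊆H (Subset.q⊆p∪q P ⁅ t₀ ⁆ (Subset.x∈⁅x⁆ t₀))))) (cong parity (∣p∪⁅x⁆∣≡1+∣p∣ P t₀∉P))

  notInH-mex : ∀ {P} → ¬ P ⊆ H → Position P → IsMexAt value P
  notInH-mex = parity-mex (λ Q → ¬ Q ⊆ H) value 0
    (λ {Q} Q⊈H → trans (value-notInH Q⊈H) (cong parity (sym (ℕ.+-identityʳ ∣ Q ∣))))
    (λ P⊈H _ Q⊆H → P⊈H (Q⊆H ∘ Subset.p⊆p∪q _))
    (λ {Q} Q⊈H terminal → trans (cong parity (ℕ.+-identityʳ ∣ Q ∣)) (terminal-⊈H⇒even terminal Q⊈H))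

  spansH-mex : ∀ {P} → P ⊆ H → SpansH P → Position P → IsMexAt value P
  spansH-mex P⊆H spans = parity-mex (λ Q → Q ⊆ H × SpansH Q) value 1
    (λ {Q} (Q⊆H , spans) → trans (value-spansH Q⊆H spans) (cong parity (ℕ.+-comm 1 ∣ Q ∣)))
    (λ {Q} {g} (Q⊆H , spans) (_ , position) →
      ∪⁅⁆-⊆ Q⊆H (decidable-stable (g Subset.∈? H) (position ∘ spansH⇒∪∉H-spans-G spans)) ,
      λ y y∈ → ⟨⟩-∪ˡ ⁅ g ⁆ (spans y y∈))
    (λ {Q} (Q⊆H , _) terminal → trans (cong parity (ℕ.+-comm ∣ Q ∣ 1)) (parity-suc-1 ∣ Q ∣ (terminal-⊆H⇒odd terminal Q⊆H)))
    (P⊆H , spans)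

  -- An even-sized P ⊆ H is not a subgroup, so some y ∈ ⟨ P ⟩ can be added without changing ⟨ P ⟩.
  oneShortOfH-reaches-2 : ∀ {P} → P ⊆ H → ¬ SpansH P → OneShortOfH P → parity (suc ∣ P ∣) ≡ 1 → Reaches value P 2
  oneShortOfH-reaches-2 {P} P⊆H ¬spans (h , h∉ , h∈H , spans) odd
    with ¬∀⇒∃¬ ⟨ P ⟩∋? (Subset._∈? P) (λ closed → parity-suc≢ ∣ P ∣ (trans odd (sym (closed-odd (λ _ → closed) (H-no-involution ∘ P⊆H)))))
  ... | y , y∈⟨P⟩ , y∉P = y , y∉P , ⊆H⇒position Q⊆H , trans (value-oneShortOfH Q⊆H ¬spansQ shortQ)
      (cong (2 +_) (trans (cong (parity ∘ suc) (∣p∪⁅x⁆∣≡1+∣p∣ P y∉P)) (parity-suc-1 (suc ∣ P ∣) odd)))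
    where
    Q : Subset N
    Q = P ∪ ⁅ y ⁆
    Q⊆H : Q ⊆ H
    Q⊆H = ∪⁅⁆-⊆ P⊆H (⟨⟩⊆H P⊆H y∈⟨P⟩)
    ¬spansQ : ¬ SpansH Q
    ¬spansQ spansQ = ¬spans λ z z∈ → ⟨⟩-absorb y∈⟨P⟩ (spansQ z z∈)
    h∉Q : h ∉ Q
    h∉Q h∈Q with Subset.x∈p∪q⁻ P ⁅ y ⁆ h∈Q
    ... | inj₁ h∈P = h∉ h∈P
    ... | inj₂ h∈y rewrite Subset.x∈⁅y⁆⇒x≡y y h∈y = ¬spans λ z z∈ → ⟨⟩-absorb y∈⟨P⟩ (spans z z∈)
    shortQ : OneShortOfH Q
    shortQ = h , h∉Q , h∈H , λ z z∈ → ⟨⟩-mono (∪-monoˡ ⁅ h ⁆ (Subset.p⊆p∪q ⁅ y ⁆)) (spans z z∈)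

  oneShortOfH-mex : ∀ {P} → P ⊆ H → ¬ SpansH P → OneShortOfH P → Position P → IsMexAt value P
  oneShortOfH-mex {P} P⊆H ¬spans short@(h , h∉ , h∈H , spans) pos = differs , reaches
    where
    k : ℕ
    k = ∣ P ∣
    valueP : value P ≡ 2 + parity (suc k)
    valueP = value-oneShortOfH P⊆H ¬spans short
    differs : ∀ g → g ∉ P → Position (P ∪ ⁅ g ⁆) → value (P ∪ ⁅ g ⁆) ≢ value P
    differs g g∉ _ e with value-≤1⊎oneShortOfH (P ∪ ⁅ g ⁆)
    ... | inj₁ ≤1 = ℕ.<⇒≱ (ℕ.≤-trans (s≤s (s≤s z≤n)) (ℕ.≤-reflexive (sym (trans e valueP)))) ≤1
    ... | inj₂ valueQ = parity-suc≢ (suc k) (ℕ.+-cancelˡ-≡ 2 _ _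
        (trans (cong (λ n → 2 + parity (suc n)) (sym (∣p∪⁅x⁆∣≡1+∣p∣ P g∉))) (trans (sym valueQ) (trans e valueP))))
    h-reaches : Reaches value P (parity (suc (suc k)))
    h-reaches = h , h∉ , ⊆H⇒position (∪⁅⁆-⊆ P⊆H h∈H) ,
      trans (value-spansH (∪⁅⁆-⊆ P⊆H h∈H) spans) (cong (parity ∘ suc) (∣p∪⁅x⁆∣≡1+∣p∣ P h∉))
    reaches : ∀ v → v < value P → Reaches value P v
    reaches v v< with v ℕ.≤? 1 | v ℕ.≟ parity (suc k)
    ... | _ | yes refl = t₀-reaches P⊆H ¬spans
    ... | yes v≤1 | no v≢ = subst (Reaches value P) (sym (parity-other (suc k) v≤1 v≢)) h-reaches
    ... | no v≰1 | _ with parity-0⊎1 (suc k) | subst (v <_) valueP v<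
    ...   | inj₁ even | v<2+p = ⊥-elim (v≰1 (ℕ.≤-pred (subst (λ p → v < 2 + p) even v<2+p)))
    ...   | inj₂ odd | v<2+p = subst (Reaches value P)
            (ℕ.≤-antisym (ℕ.≰⇒> v≰1) (ℕ.≤-pred (subst (λ p → v < 2 + p) odd v<2+p))) (oneShortOfH-reaches-2 P⊆H ¬spans short odd)

  farFromH-mex : ∀ {P} → P ⊆ H → ¬ SpansH P → ¬ OneShortOfH P → Position P → IsMexAt value P
  farFromH-mex {P} P⊆H ¬spans ¬short pos = differs , reaches
    where
    valueP : value P ≡ parity ∣ P ∣
    valueP = value-farFromH P⊆H ¬spans ¬short
    differs : ∀ g → g ∉ P → Position (P ∪ ⁅ g ⁆) → value (P ∪ ⁅ g ⁆) ≢ value P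
    differs g g∉ _ e with classify (P ∪ ⁅ g ⁆)
    ... | notInH _ = parity-suc≢ ∣ P ∣ (trans (cong parity (sym (∣p∪⁅x⁆∣≡1+∣p∣ P g∉))) (trans e valueP))
    ... | spansH Q⊆H spansQ = ¬short (g , g∉ , Q⊆H (Subset.q⊆p∪q P ⁅ g ⁆ (Subset.x∈⁅x⁆ g)) , spansQ)
    ... | oneShortOfH _ _ _ = ℕ.<⇒≱ (s≤s (s≤s z≤n)) (ℕ.≤-trans (ℕ.≤-reflexive (trans e valueP)) (parity≤1 ∣ P ∣))
    ... | farFromH _ _ _ = parity-suc≢ ∣ P ∣ (trans (cong parity (sym (∣p∪⁅x⁆∣≡1+∣p∣ P g∉))) (trans e valueP))
    reaches : ∀ v → v < value P → Reaches value P v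
    reaches v v< = subst (Reaches value P) (parity-suc-< ∣ P ∣ (subst (v <_) valueP v<)) (t₀-reaches P⊆H ¬spans)

  mex-by-class : ∀ {P} → Class P → Position P → IsMexAt value P
  mex-by-class (notInH P⊈H) = notInH-mex P⊈H
  mex-by-class (spansH P⊆H spans) = spansH-mex P⊆H spans
  mex-by-class (oneShortOfH P⊆H ¬spans short) = oneShortOfH-mex P⊆H ¬spans short
  mex-by-class (farFromH P⊆H ¬spans ¬short) = farFromH-mex P⊆H ¬spans ¬short

  value-nim : IsNimFunction G value
  value-nim P = mex-by-class (classify P)

  open ParityCases G using (position-∅)

  instance
    m-nonZero : NonZero m
    m-nonZero = ℕ.≢-nonZero λ m≡0 → ℕ.0≢1+n (trans (cong parity (sym m≡0)) m-odd)

  2≤N : 2 ≤ N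
  2≤N = subst (2 ≤_) (sym N≡2m) (ℕ.+-mono-≤ (ℕ.>-nonZero⁻¹ m) (ℕ.>-nonZero⁻¹ m))

  ∅⊆H : ⊥ ⊆ H
  ∅⊆H = ⊥-elim ∘ Subset.∉⊥

  nimNumber-value : ∀ {v} → value ⊥ ≡ v → NimNumberIs G v
  nimNumber-value e = subst (NimNumberIs G) e (nimNumber value-nim (position-∅ 2≤N))

  spansH-∅-nim : SpansH ⊥ → NimNumberIs G 1
  spansH-∅-nim spans = nimNumber-value (trans (value-spansH ∅⊆H spans) (cong (parity ∘ suc) (Subset.∣⊥∣≡0 N)))

  oneShortOfH-∅-nim : ¬ SpansH ⊥ → OneShortOfH ⊥ → NimNumberIs G 3
  oneShortOfH-∅-nim ¬spans short = nimNumber-value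
    (trans (value-oneShortOfH ∅⊆H ¬spans short) (cong (λ k → 2 + parity (suc k)) (Subset.∣⊥∣≡0 N)))

  farFromH-∅-nim : ¬ SpansH ⊥ → ¬ OneShortOfH ⊥ → NimNumberIs G 0
  farFromH-∅-nim ¬spans ¬short = nimNumber-value (trans (value-farFromH ∅⊆H ¬spans ¬short) (cong parity (Subset.∣⊥∣≡0 N)))

  m≡1⇒spansH-∅ : m ≡ 1 → SpansH ⊥
  m≡1⇒spansH-∅ m≡1 y y∈ = subst (⟨ ⊥ ⟩∋_) (trans (sym (∈H⁻ y∈)) (trans (cong (y ^_) m≡1) (identityʳ y))) idt

  spansH-∅⇒ε⊎t₀ : SpansH ⊥ → ∀ x → x ≡ ε ⊎ x ≡ t₀
  spansH-∅⇒ε⊎t₀ spans x with x Subset.∈? H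
  ... | yes x∈ = inj₁ (⟨∅⟩∋⇒≡ε (spans x x∈))
  ... | no x∉ = inj₂ (trans (sym (∙-involutive t₀∙t₀≡ε x))
                  (trans (cong (t₀ ∙_) (⟨∅⟩∋⇒≡ε (spans _ (∉H⇒t₀∙∈H x∉)))) (identityʳ t₀)))

  spansH-∅⇒N≤2 : SpansH ⊥ → N ≤ 2
  spansH-∅⇒N≤2 spans = Fin.injective⇒≤ {f = index} index-injective
    where
    index : Fin N → Fin 2
    index x with spansH-∅⇒ε⊎t₀ spans x
    ... | inj₁ _ = fzero
    ... | inj₂ _ = fsuc fzero
    index-injective : Injective _≡_ _≡_ index
    index-injective {x} {y} e with spansH-∅⇒ε⊎t₀ spans x | spansH-∅⇒ε⊎t₀ spans y
    ... | inj₁ x≡ε | inj₁ y≡ε = trans x≡ε (sym y≡ε)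
    ... | inj₂ x≡t₀ | inj₂ y≡t₀ = trans x≡t₀ (sym y≡t₀)
    ... | inj₁ _ | inj₂ _ = ⊥-elim (Fin.0≢1+n e)
    ... | inj₂ _ | inj₁ _ = ⊥-elim (Fin.0≢1+n (sym e))

  m≡1⇒iso : m ≡ 1 → IsoTo G (Fin 2) (addℤ 2)
  m≡1⇒iso m≡1 = surjective-hom⇒iso {_⊕_ = addℤ 2} enum ψ ψ-hom ψ-surjective
    where
    enum : Fin N ↔ Fin 2
    enum = subst (λ n → Fin n ↔ Fin 2) (sym (trans N≡2m (cong (λ k → k + k) m≡1))) ↔-refl
    ψ : Fin 2 → Fin N
    ψ a = t₀ ^ toℕ a
    ψ-hom : ∀ a b → ψ (addℤ 2 a b) ≡ ψ a ∙ ψ b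
    ψ-hom a b = trans (cong (t₀ ^_) (toℕ-addℤ 2 a b)) (trans (sym (^-mod 2 t₀²≡ε (toℕ a + toℕ b))) (^-+ t₀ (toℕ a) (toℕ b)))
    ψ-surjective : ∀ x → ∃ λ a → ψ a ≡ x
    ψ-surjective x with spansH-∅⇒ε⊎t₀ (m≡1⇒spansH-∅ m≡1) x
    ... | inj₁ x≡ε = fzero , sym x≡ε
    ... | inj₂ x≡t₀ = fsuc fzero , trans (identityʳ t₀) (sym x≡t₀)

  oneShortOfH-∅⇒iso : OneShortOfH ⊥ → IsoTo G (Fin 2 × Fin m) (addℤ2× m)
  oneShortOfH-∅⇒iso (h , _ , h∈H , spans) = surjective-hom⇒iso {_⊕_ = addℤ2× m} enum ψ ψ-hom ψ-surjective
    where
    enum : Fin N ↔ (Fin 2 × Fin m)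
    enum = subst (λ n → Fin n ↔ (Fin 2 × Fin m)) (sym (trans N≡2m (cong (m +_) (sym (ℕ.+-identityʳ m))))) Fin.*↔×
    ψ : Fin 2 × Fin m → Fin N
    ψ (a , b) = t₀ ^ toℕ a ∙ h ^ toℕ b
    ψ-hom : ∀ u v → ψ (addℤ2× m u v) ≡ ψ u ∙ ψ v
    ψ-hom (a , b) (c , d) = begin
        t₀ ^ toℕ (addℤ 2 a c) ∙ h ^ toℕ (addℤ m b d)         ≡⟨ cong₂ (λ i j → t₀ ^ i ∙ h ^ j) (toℕ-addℤ 2 a c) (toℕ-addℤ m b d) ⟩
        t₀ ^ ((toℕ a + toℕ c) % 2) ∙ h ^ ((toℕ b + toℕ d) % m)
          ≡⟨ cong₂ _∙_ (^-mod 2 t₀²≡ε (toℕ a + toℕ c)) (^-mod m (∈H⁻ h∈H) (toℕ b + toℕ d)) ⟨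
        t₀ ^ (toℕ a + toℕ c) ∙ h ^ (toℕ b + toℕ d)           ≡⟨ cong₂ _∙_ (^-+ t₀ (toℕ a) (toℕ c)) (^-+ h (toℕ b) (toℕ d)) ⟩
        t₀ ^ toℕ a ∙ t₀ ^ toℕ c ∙ (h ^ toℕ b ∙ h ^ toℕ d)    ≡⟨ interchange _ _ _ _ ⟩
        ψ (a , b) ∙ ψ (c , d)                                ∎
      where open ≡-Reasoning
    H-power : ∀ {y} → y ∈ H → ∃ λ b → h ^ toℕ b ≡ y
    H-power {y} y∈ with ⟨⁅x⁆⟩∋⇒power (spans y y∈)
    ... | k , hᵏ≡y = fromℕ< (ℕ.m%n<n k m) ,
        trans (cong (h ^_) (Fin.toℕ-fromℕ< (ℕ.m%n<n k m))) (trans (sym (^-mod m (∈H⁻ h∈H) k)) hᵏ≡y)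
    ψ-surjective : ∀ x → ∃ λ a → ψ a ≡ x
    ψ-surjective x with x Subset.∈? H
    ... | yes x∈ = let b , hᵇ≡x = H-power x∈ in (fzero , b) , trans (identityˡ _) hᵇ≡x
    ... | no x∉ = let b , hᵇ≡t₀x = H-power (∉H⇒t₀∙∈H x∉) in
        (fsuc fzero , b) , trans (cong₂ _∙_ (identityʳ t₀) hᵇ≡t₀x) (∙-involutive t₀∙t₀≡ε x)

  3≤m⇒¬spansH-∅ : 3 ≤ m → ¬ SpansH ⊥
  3≤m⇒¬spansH-∅ 3≤m spans = ℕ.<⇒≱ (subst (2 <_) (sym N≡2m) (ℕ.≤-trans 3≤m (ℕ.m≤m+n m m))) (spansH-∅⇒N≤2 spans)

  far⊎iso : 3 ≤ m → NimNumberIs G 0 ⊎ IsoTo G (Fin 2 × Fin m) (addℤ2× m)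
  far⊎iso 3≤m with oneShortOfH? ⊥
  ... | yes short = inj₂ (oneShortOfH-∅⇒iso short)
  ... | no ¬short = inj₁ (farFromH-∅-nim (3≤m⇒¬spansH-∅ 3≤m) ¬short)

module ProductIso (G : FiniteAbelianGroup) (M : ℕ) (3≤M : 3 ≤ M) (M-odd : parity M ≡ 1)
                  (iso : IsoTo G (Fin 2 × Fin M) (addℤ2× M)) where
  open FiniteAbelianGroup G renaming (order to N; _∙_ to infixl 7 _∙_; _⁻¹ to infix 8 _⁻¹)
  open Span G
  open GroupTheory G

  1<M : 1 < M
  1<M = ℕ.≤-trans (s≤s (s≤s z≤n)) 3≤M

  instance
    M-nonZero : NonZero M
    M-nonZero = ℕ.>-nonZero (ℕ.<-trans (s≤s z≤n) 1<M)

  N≡2M : N ≡ M + M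
  N≡2M = trans (iso-order {_⊕_ = addℤ2× M} iso Fin.*↔×) (cong (M +_) (ℕ.+-identityʳ M))

  open TwiceOdd G M N≡2M M-odd

  φ : Fin N → Fin 2 × Fin M
  φ = proj₁ iso

  φ-hom : ∀ x y → φ (x ∙ y) ≡ addℤ2× M (φ x) (φ y)
  φ-hom = proj₂ (proj₂ iso)

  toℕ-φ₁-^ : ∀ x j → toℕ (proj₁ (φ (x ^ j))) ≡ (j * toℕ (proj₁ (φ x))) % 2
  toℕ-φ₁-^ = toℕ-hom-^ (proj₁ ∘ φ) (λ x y → cong proj₁ (φ-hom x y))

  toℕ-φ₂-^ : ∀ x j → toℕ (proj₂ (φ (x ^ j))) ≡ (j * toℕ (proj₂ (φ x))) % M
  toℕ-φ₂-^ = toℕ-hom-^ (proj₂ ∘ φ) (λ x y → cong proj₂ (φ-hom x y))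

  same-coordinates : ∀ {x y} → toℕ (proj₁ (φ x)) ≡ toℕ (proj₁ (φ y)) → toℕ (proj₂ (φ x)) ≡ toℕ (proj₂ (φ y)) → x ≡ y
  same-coordinates e₁ e₂ = proj₁ (proj₁ (proj₂ iso)) (cong₂ _,_ (Fin.toℕ-injective e₁) (Fin.toℕ-injective e₂))

  h₀ : Fin N
  h₀ = proj₁ (proj₂ (proj₁ (proj₂ iso)) (fzero , fromℕ< 1<M))

  φh₀ : φ h₀ ≡ (fzero , fromℕ< 1<M)
  φh₀ = proj₂ (proj₂ (proj₁ (proj₂ iso)) (fzero , fromℕ< 1<M)) refl

  toℕ-φ₁-h₀^ : ∀ j → toℕ (proj₁ (φ (h₀ ^ j))) ≡ 0
  toℕ-φ₁-h₀^ j = begin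
    toℕ (proj₁ (φ (h₀ ^ j)))             ≡⟨ toℕ-φ₁-^ h₀ j ⟩
    (j * toℕ (proj₁ (φ h₀))) % 2         ≡⟨ cong (λ a → (j * toℕ (proj₁ a)) % 2) φh₀ ⟩
    (j * 0) % 2                          ≡⟨ cong (_% 2) (ℕ.*-zeroʳ j) ⟩
    0                                    ∎
    where open ≡-Reasoning

  toℕ-φ₂-h₀^ : ∀ j → toℕ (proj₂ (φ (h₀ ^ j))) ≡ j % M
  toℕ-φ₂-h₀^ j = begin
    toℕ (proj₂ (φ (h₀ ^ j)))             ≡⟨ toℕ-φ₂-^ h₀ j ⟩
    (j * toℕ (proj₂ (φ h₀))) % M         ≡⟨ cong (λ a → (j * toℕ (proj₂ a)) % M) φh₀ ⟩
    (j * toℕ (fromℕ< 1<M)) % M           ≡⟨ cong (λ i → (j * i) % M) (Fin.toℕ-fromℕ< 1<M) ⟩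
    (j * 1) % M                          ≡⟨ cong (_% M) (ℕ.*-identityʳ j) ⟩
    j % M                                ∎
    where open ≡-Reasoning

  toℕ-φ₁-ε : toℕ (proj₁ (φ ε)) ≡ 0
  toℕ-φ₁-ε = toℕ-hom-ε (proj₁ ∘ φ) (λ x y → cong proj₁ (φ-hom x y))

  toℕ-φ₂-ε : toℕ (proj₂ (φ ε)) ≡ 0
  toℕ-φ₂-ε = toℕ-hom-ε (proj₂ ∘ φ) (λ x y → cong proj₂ (φ-hom x y))

  h₀∈H : h₀ ∈ H
  h₀∈H = ∈H⁺ (same-coordinates (trans (toℕ-φ₁-h₀^ M) (sym toℕ-φ₁-ε))
                               (trans (toℕ-φ₂-h₀^ M) (trans (ℕ.n%n≡0 M) (sym toℕ-φ₂-ε))))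

  -- Since M is odd, y ^ M ≡ ε forces the ℤ₂-coordinate of y to vanish.
  H-cyclic : ∀ {y} → y ∈ H → y ≡ h₀ ^ toℕ (proj₂ (φ y))
  H-cyclic {y} y∈ = same-coordinates (trans (first-zero (proj₁ (φ y)) refl) (sym (toℕ-φ₁-h₀^ b)))
    (sym (trans (toℕ-φ₂-h₀^ b) (ℕ.m<n⇒m%n≡m (Fin.toℕ<n (proj₂ (φ y))))))
    where
    b : ℕ
    b = toℕ (proj₂ (φ y))
    Ma%2≡0 : (M * toℕ (proj₁ (φ y))) % 2 ≡ 0
    Ma%2≡0 = trans (sym (toℕ-φ₁-^ y M)) (trans (cong (toℕ ∘ proj₁ ∘ φ) (∈H⁻ y∈)) toℕ-φ₁-ε)
    first-zero : ∀ a → proj₁ (φ y) ≡ a → toℕ (proj₁ (φ y)) ≡ 0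
    first-zero fzero e = cong toℕ e
    first-zero (fsuc fzero) e = ⊥-elim (ℕ.0≢1+n (begin
      0                   ≡⟨ Ma%2≡0 ⟨
      (M * toℕ (proj₁ (φ y))) % 2 ≡⟨ cong (λ a → (M * toℕ a) % 2) e ⟩
      (M * 1) % 2         ≡⟨ cong (_% 2) (ℕ.*-identityʳ M) ⟩
      M % 2               ≡⟨ n%2≡parity M ⟩
      parity M            ≡⟨ M-odd ⟩
      1                   ∎))
      where open ≡-Reasoning

  oneShortOfH-∅ : OneShortOfH ⊥
  oneShortOfH-∅ = h₀ , Subset.∉⊥ , h₀∈H ,
    λ y y∈ → subst (⟨ ⊥ ∪ ⁅ h₀ ⁆ ⟩∋_) (sym (H-cyclic y∈)) (⟨⟩-^ (toℕ (proj₂ (φ y))) (⟨⟩-∪-⁅⁆ ⊥ h₀))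

  product-nim : NimNumberIs G 3
  product-nim = oneShortOfH-∅-nim (3≤m⇒¬spansH-∅ 3≤M) oneShortOfH-∅

even-order-nim : ∀ G → 2 ≤ FiniteAbelianGroup.order G → parity (FiniteAbelianGroup.order G) ≡ 0 →
  ¬ IsoℤZ2 G → ¬ (∃ λ k → 1 ≤ k × IsoZ2×Z G (2 * k + 1)) → NimNumberIs G 0
even-order-nim G 2≤N even ¬ℤ₂ ¬product with parity≡0⇒double _ even
... | c , N≡2c with parity-0⊎1 c
...   | inj₁ c-even = ParityCases.doubly-even-nim G 2≤N even
        (λ c′ N≡2c′ → subst (λ n → parity n ≡ 0) (double-injective c c′ (trans (sym N≡2c) N≡2c′)) c-even)
...   | inj₂ c-odd with parity≡1⇒2k+1 c c-odd
...     | zero , refl = ⊥-elim (¬ℤ₂ (TwiceOdd.m≡1⇒iso G 1 N≡2c c-odd refl))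
...     | suc k , refl with TwiceOdd.far⊎iso G _ N≡2c c-odd (3≤2k+1 (s≤s z≤n))
...       | inj₁ nim = nim
...       | inj₂ iso = ⊥-elim (¬product (suc k , s≤s z≤n , iso))

proposition8p2 : (G : FiniteAbelianGroup) → 2 ≤ FiniteAbelianGroup.order G →
    (OddOrder G → NimNumberIs G 1)
  × (IsoℤZ2 G → NimNumberIs G 1)
  × (∀ k → 1 ≤ k → IsoZ2×Z G (2 * k + 1) → NimNumberIs G 3)
  × (¬ OddOrder G → ¬ IsoℤZ2 G → ¬ (∃ λ k → 1 ≤ k × IsoZ2×Z G (2 * k + 1)) → NimNumberIs G 0)
proposition8p2 G 2≤N = odd-case , ℤ₂-case , product-case , remaining-case
  where
  open FiniteAbelianGroup G using () renaming (order to N)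
  odd-case : OddOrder G → NimNumberIs G 1
  odd-case odd = ParityCases.odd-order-nim G 2≤N (trans (sym (n%2≡parity N)) odd)
  ℤ₂-case : IsoℤZ2 G → NimNumberIs G 1
  ℤ₂-case iso = TwiceOdd.spansH-∅-nim G 1 N≡2 refl (TwiceOdd.m≡1⇒spansH-∅ G 1 N≡2 refl refl)
    where
    N≡2 : N ≡ 2
    N≡2 = GroupTheory.iso-order G {_⊕_ = addℤ 2} iso ↔-refl
  product-case : ∀ k → 1 ≤ k → IsoZ2×Z G (2 * k + 1) → NimNumberIs G 3
  product-case k 1≤k = ProductIso.product-nim G (2 * k + 1) (3≤2k+1 1≤k) (parity-2k+1 k)
  remaining-case : ¬ OddOrder G → ¬ IsoℤZ2 G → ¬ (∃ λ k → 1 ≤ k × IsoZ2×Z G (2 * k + 1)) → NimNumberIs G 0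
  remaining-case ¬odd with parity-0⊎1 N
  ... | inj₁ even = even-order-nim G 2≤N even
  ... | inj₂ odd = ⊥-elim (¬odd (trans (n%2≡parity N) odd))
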